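{- Let $G$ be a graph that is not a matching, let $H$ be a nonempty graph, and fix a subgraph $G_-\subseteq G$ with $e(G_-)=e(G)-1$ and $v(G_-)=v(G)$. Let a graph $G_-^H\in\mathcal F(G_-,H)$ with central copy $G'_-$ be given, and let $g$ be a vertex pair that completes $G'_-$ to a copy of $G$ when inserted as an edge. Then every subgraph $J\subseteq G_-^H$ that contains the two vertices of $g$ satisfies $$v(J)-\frac{e(J)}{m_2(G,H)}\geq 2-L(G_-^H).$$
   Context: For a graph $F$, $e(F)=e_F$ and $v(F)=v_F$ denote its numbers of edges and vertices; a graph is nonempty if it has at least one edge and a matching if it has maximum degree at most $1$. For a graph $H$ define $d_2(H)=(e_H-1)/(v_H-2)$ if $v_H\geq 3$, $d_2(K_2)=1/2$, and $d_2(H)=0$ if $e_H=0$; let $m_2(H)=\max_{J\subseteq H} d_2(J)$. For graphs $G,H$ define $d_2(G,H)=e_H/(v_H-2+1/m_2(G))$ if $e_G,e_H\geq 1$ and $0$ otherwise; let $m_2(G,H)=\max_{J\subseteq H}d_2(G,J)$. For graphs $G,H$, $\mathcal F(G,H)$ is the family of all graphs obtained by taking a copy of $G$ and embedding each of its edges into a copy of $H$ such that these $e_G$ copies of $H$ are pairwise edge-disjoint (not necessarily vertex-disjoint); a copy of $G$ that can be used in this way to construct a given $G^H\in\mathcal F(G,H)$ is called a central copy of $G$ in $G^H$. For $G^H\in\mathcal F(G,H)$ set $L(G^H)=v_G+e_G(v_H-2)-v(G^H)$. -}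

module Defs where

open import Data.Nat as ℕ using (ℕ; zero; suc; _∸_)
open import Data.Integer as ℤ using (ℤ; +_)
open import Data.Rational as ℚ using (ℚ; 0ℚ; _÷_; _/_)
open import Data.Rational.Properties using (_≟_)
open import Data.Fin using (Fin; toℕ; zero; suc)
open import Data.Fin.Properties using () renaming (_≟_ to _≟ᶠ_)
open import Data.Bool using (Bool; true; false; _∧_; _∨_; if_then_else_)
open import Data.Product using (Σ; ∃; _×_; _,_)
open import Data.Sum using (_⊎_)
open import Relation.Nullary using (¬_; yes; no; does)
open import Relation.Binary.PropositionalEquality using (_≡_; _≢_)
open import Function.Definitions using (Injective)
open import Data.Fin.Permutation using (Permutation′; _⟨$⟩ʳ_)

record Graph (n : ℕ) : Set where
  field
    adj : Fin n → Fin n → Bool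
    adj-sym : ∀ i j → adj i j ≡ adj j i
    adj-irr : ∀ i → adj i i ≡ false
open Graph public

sumFin : ∀ {n} → (Fin n → ℕ) → ℕ
sumFin {zero}  f = 0
sumFin {suc n} f = f zero ℕ.+ sumFin (λ i → f (suc i))

count : ∀ {n} → (Fin n → Bool) → ℕ
count p = sumFin (λ i → if p i then 1 else 0)

countPairs : ∀ {n} → (Fin n → Fin n → Bool) → ℕ
countPairs {n} r =
  sumFin (λ i → sumFin (λ j → if does (toℕ i ℕ.<? toℕ j) ∧ r i j then 1 else 0))

v : ∀ {n} → Graph n → ℕ
v {n} _ = n

e : ∀ {n} → Graph n → ℕ
e G = countPairs (adj G)

IsMatching : ∀ {n} → Graph n → Set
IsMatching G = ∀ x y z → adj G x y ≡ true → adj G x z ≡ true → y ≡ z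

record Subgraph {n : ℕ} (G : Graph n) : Set where
  field
    vs : Fin n → Bool
    es : Fin n → Fin n → Bool
    es-sym : ∀ i j → es i j ≡ es j i
    es-adj : ∀ i j → es i j ≡ true → adj G i j ≡ true
    es-vs  : ∀ i j → es i j ≡ true → vs i ≡ true
open Subgraph public

vS : ∀ {n} {G : Graph n} → Subgraph G → ℕ
vS J = count (vs J)

eS : ∀ {n} {G : Graph n} → Subgraph G → ℕ
eS J = countPairs (es J)

ℕ→ℚ : ℕ → ℚ
ℕ→ℚ k = + k / 1

ℤ→ℚ : ℤ → ℚ
ℤ→ℚ k = k / 1

-- division, used only where the divisor is nonzero (returns 0 otherwise)
_÷₀_ : ℚ → ℚ → ℚ
p ÷₀ q with q ≟ 0ℚ
... | yes _ = 0ℚ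
... | no q≢0 = _÷_ p q {{ℚ.≢-nonZero q≢0}}

d₂ : ℕ → ℕ → ℚ
d₂ vH zero = 0ℚ
d₂ zero (suc _) = 0ℚ      -- impossible for a graph
d₂ (suc zero) (suc _) = 0ℚ -- impossible for a graph
d₂ (suc (suc zero)) (suc _) = + 1 / 2           -- K₂
d₂ (suc (suc (suc k))) (suc m) = + m / suc k   -- (e - 1)/(v - 2), v ≥ 3

IsMaxOverSubgraphs : ∀ {n} (H : Graph n) → (Subgraph H → ℚ) → ℚ → Set
IsMaxOverSubgraphs H f q = (Σ (Subgraph H) λ J → f J ≡ q) × (∀ J → f J ℚ.≤ q)

IsM₂ : ∀ {n} → Graph n → ℚ → Set
IsM₂ H q = IsMaxOverSubgraphs H (λ J → d₂ (vS J) (eS J)) q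

-- d₂(G,J) where e_G = eG, m₂(G) = mG, and J has vJ vertices, eJ edges
d₂′ : ℕ → ℚ → ℕ → ℕ → ℚ
d₂′ zero mG vJ eJ = 0ℚ
d₂′ (suc _) mG vJ zero = 0ℚ
d₂′ (suc _) mG vJ (suc k) =
  ℕ→ℚ (suc k) ÷₀ ((ℤ→ℚ (+ vJ ℤ.- + 2)) ℚ.+ (ℕ→ℚ 1 ÷₀ mG))

IsM₂′ : ∀ {nG nH} → Graph nG → Graph nH → ℚ → ℚ → Set
IsM₂′ G H mG q = IsMaxOverSubgraphs H (λ J → d₂′ (e G) mG (vS J) (eS J)) q

-- the family 𝓕(G,H): K ∈ 𝓕(G,H) with central copy given by φ and the
-- copies of H given by ψ (ψ i j is the copy of H containing the image of
-- the edge ij of G, for i < j; its values for other pairs are irrelevant)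

IsEdge< : ∀ {n} → Graph n → Fin n → Fin n → Set
IsEdge< G i j = (toℕ i ℕ.< toℕ j) × adj G i j ≡ true

record CentralCopy {nG nH N} (G : Graph nG) (H : Graph nH) (K : Graph N)
                   (φ : Fin nG → Fin N) : Set where
  field
    ψ : Fin nG → Fin nG → Fin nH → Fin N
    φ-inj : Injective _≡_ _≡_ φ
    ψ-inj : ∀ i j → IsEdge< G i j → Injective _≡_ _≡_ (ψ i j)
    ψ-hom : ∀ i j → IsEdge< G i j → ∀ a b → adj H a b ≡ true →
            adj K (ψ i j a) (ψ i j b) ≡ true
    ψ-contains : ∀ i j → IsEdge< G i j →
            Σ (Fin nH) λ a → Σ (Fin nH) λ b → adj H a b ≡ true ×
              ψ i j a ≡ φ i × ψ i j b ≡ φ j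
    ψ-disjoint : ∀ i j i′ j′ → IsEdge< G i j → IsEdge< G i′ j′ →
            ¬ (i ≡ i′ × j ≡ j′) →
            ∀ a b a′ b′ → adj H a b ≡ true → adj H a′ b′ ≡ true →
            ¬ (ψ i j a ≡ ψ i′ j′ a′ × ψ i j b ≡ ψ i′ j′ b′)
    vertices-covered : ∀ x → (Σ (Fin nG) λ u → φ u ≡ x) ⊎
            (Σ (Fin nG) λ i → Σ (Fin nG) λ j → Σ (Fin nH) λ a →
              IsEdge< G i j × ψ i j a ≡ x)
    edges-covered : ∀ x y → adj K x y ≡ true →
            Σ (Fin nG) λ i → Σ (Fin nG) λ j → Σ (Fin nH) λ a → Σ (Fin nH) λ b →
              IsEdge< G i j × adj H a b ≡ true × ψ i j a ≡ x × ψ i j b ≡ y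

L : ∀ {nG nH N} → Graph nG → Graph nH → Graph N → ℤ
L {nG} {nH} {N} G H K = + nG ℤ.+ (+ e G) ℤ.* (+ nH ℤ.- + 2) ℤ.- + N

addPair : ∀ {n} → (Fin n → Fin n → Bool) → Fin n → Fin n → Fin n → Fin n → Bool
addPair r u w i j =
  r i j ∨ ((does (i ≟ᶠ u) ∧ does (j ≟ᶠ w)) ∨ (does (i ≟ᶠ w) ∧ does (j ≟ᶠ u)))

IsoTo : ∀ {n} → (Fin n → Fin n → Bool) → Graph n → Set
IsoTo {n} r G = Σ (Permutation′ n) λ σ →
  ∀ i j → adj G i j ≡ r (σ ⟨$⟩ʳ i) (σ ⟨$⟩ʳ j)

-- Write m = m₂(G,H) and c = 1/m₂(G).  Every edge of J lies in one of the copies H_ij of H, so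
-- e(J) ≤ Σ e(J ∩ H_ij).  If J ∩ H_ij has an edge, d₂(G, J ∩ H_ij) ≤ m gives
-- e(J ∩ H_ij) ≤ m (v(J ∩ H_ij) − 2 + c).  As G is not a matching it contains a path with two
-- edges, so m₂(G) ≥ 1 and c ≤ 1; hence the bracket is at most y_ij + c·[φ i, φ j ∈ J], where y_ij
-- counts the vertices of H_ij in J other than φ i and φ j.  Summing, e(J) ≤ m (y + c ε), with ε
-- the number of edges of the central copy inside J.  Those ε edges together with g span a
-- subgraph of G on the a central vertices of J, so ε ≤ m₂(G) (a − 2), i.e. c ε ≤ a − 2 (for a = 2
-- there are no such edges).  Finally every vertex of G₋^H is central or one of the v_H − 2 further
-- vertices of some copy, which gives a + y ≤ v(J) + L(G₋^H) and so e(J)/m ≤ v(J) − 2 + L(G₋^H).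

module Submission where

open import Defs
open import Data.Fin using (Fin; toℕ) renaming (zero to fz; suc to fs)
open import Data.Fin.Properties using (toℕ-injective; ¬∀⟶∃¬; all?)
  renaming (_≟_ to _≟ᶠ_; suc-injective to fsuc-injective)
open import Data.Fin.Permutation using (Permutation′; _⟨$⟩ʳ_)
open import Data.Bool using (Bool; true; false; _∧_; _∨_; not; if_then_else_)
import Data.Bool as Bool
open import Data.Bool.Properties using (∨-comm; ∨-identityʳ; ∨-zeroʳ; ∧-identityʳ; ∧-zeroʳ)
open import Data.Product using (Σ; _×_; _,_; proj₂)
open import Data.Sum using (_⊎_; inj₁; inj₂)
open import Data.Empty using (⊥-elim)
open import Relation.Nullary using (¬_; Dec; yes; no; does)
open import Relation.Nullary.Decidable using (dec-true; dec-false; _→-dec_)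
open import Relation.Binary using (tri<; tri≈; tri>)
open import Relation.Binary.PropositionalEquality
open import Function using (_∘_)
open import Function.Definitions using (Injective)

module FiniteSums where

  open import Data.Nat using (ℕ; zero; suc; _+_; _*_; _≤_; _<?_; z≤n; s≤s)
  open import Data.Nat.Properties
  open import Algebra.Properties.Semiring.Sum +-*-semiring public
    using (sum; sum-syntax; sum-cong-≗; ∑-distrib-+; ∑-comm; ∑-permute; *-distribˡ-sum)

  ⟦_⟧ : Bool → ℕ
  ⟦ b ⟧ = if b then 1 else 0

  ⟦∧⟧ : ∀ a b → ⟦ a ∧ b ⟧ ≡ ⟦ a ⟧ * ⟦ b ⟧
  ⟦∧⟧ true  b = sym (+-identityʳ ⟦ b ⟧)
  ⟦∧⟧ false b = refl

  ⟦∧⟧*⟦∧⟧ : ∀ a b c d → ⟦ a ∧ b ⟧ * ⟦ c ∧ d ⟧ ≡ ⟦ a ∧ (c ∧ (d ∧ b)) ⟧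
  ⟦∧⟧*⟦∧⟧ false b c     d     = refl
  ⟦∧⟧*⟦∧⟧ true  b false d     = *-zeroʳ ⟦ b ⟧
  ⟦∧⟧*⟦∧⟧ true  b true  false = *-zeroʳ ⟦ b ⟧
  ⟦∧⟧*⟦∧⟧ true  b true  true  = *-identityʳ ⟦ b ⟧

  ⟦∨⟧-disjoint : ∀ a b → a ∧ b ≡ false → ⟦ a ∨ b ⟧ ≡ ⟦ a ⟧ + ⟦ b ⟧
  ⟦∨⟧-disjoint true  true  ()
  ⟦∨⟧-disjoint true  false _ = refl
  ⟦∨⟧-disjoint false b     _ = refl

  ⟦⟧-positive : ∀ {b} → 1 ≤ ⟦ b ⟧ → b ≡ true
  ⟦⟧-positive {true} _ = refl

  infix 4 _==_
  _==_ : ∀ {n} → Fin n → Fin n → Bool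
  x == y = does (x ≟ᶠ y)

  ==-refl : ∀ {n} (x : Fin n) → (x == x) ≡ true
  ==-refl x = dec-true (x ≟ᶠ x) refl

  ==-false : ∀ {n} {x y : Fin n} → x ≢ y → (x == y) ≡ false
  ==-false {x = x} {y} = dec-false (x ≟ᶠ y)

  ==-sym : ∀ {n} (x y : Fin n) → (x == y) ≡ (y == x)
  ==-sym x y with x ≟ᶠ y | y ≟ᶠ x
  ... | yes _   | yes _   = refl
  ... | no _    | no _    = refl
  ... | yes x≡y | no y≢x  = ⊥-elim (y≢x (sym x≡y))
  ... | no x≢y  | yes y≡x = ⊥-elim (x≢y (sym y≡x))

  sumFin≡sum : ∀ {n} (f : Fin n → ℕ) → sumFin f ≡ sum f
  sumFin≡sum {zero}  f = refl
  sumFin≡sum {suc n} f = cong (f fz +_) (sumFin≡sum (λ i → f (fs i)))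

  sum-mono : ∀ {n} {f g : Fin n → ℕ} → (∀ i → f i ≤ g i) → sum f ≤ sum g
  sum-mono {zero}  le = z≤n
  sum-mono {suc n} le = +-mono-≤ (le fz) (sum-mono (λ i → le (fs i)))

  sum-ones : ∀ n → ∑[ i < n ] 1 ≡ n
  sum-ones zero    = refl
  sum-ones (suc n) = cong suc (sum-ones n)

  sum-zero : ∀ {n} (f : Fin n → ℕ) → (∀ i → f i ≡ 0) → sum f ≡ 0
  sum-zero {zero}  f eq = refl
  sum-zero {suc n} f eq = cong₂ _+_ (eq fz) (sum-zero (λ i → f (fs i)) (λ i → eq (fs i)))

  sum-term : ∀ {n} (f : Fin n → ℕ) (i : Fin n) → f i ≤ sum f
  sum-term f fz     = m≤m+n _ _
  sum-term f (fs i) = ≤-trans (sum-term (λ k → f (fs k)) i) (m≤n+m _ (f fz))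

  sum-two : ∀ {n} (f : Fin n → ℕ) (i j : Fin n) → i ≢ j → f i + f j ≤ sum f
  sum-two f fz     fz     i≢j = ⊥-elim (i≢j refl)
  sum-two f fz     (fs j) _   = +-monoʳ-≤ (f fz) (sum-term (λ k → f (fs k)) j)
  sum-two f (fs i) fz     _   = subst (_≤ sum f) (+-comm (f fz) (f (fs i)))
                                  (+-monoʳ-≤ (f fz) (sum-term (λ k → f (fs k)) i))
  sum-two f (fs i) (fs j) i≢j =
    ≤-trans (sum-two (λ k → f (fs k)) i j (λ i≡j → i≢j (cong fs i≡j))) (m≤n+m _ (f fz))

  sum-positive : ∀ {n} (f : Fin n → ℕ) → 1 ≤ sum f → Σ (Fin n) λ i → 1 ≤ f i
  sum-positive {suc n} f 1≤Σf with f fz in eq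
  ... | suc _ = fz , subst (1 ≤_) (sym eq) (s≤s z≤n)
  ... | zero  = let i , 1≤fi = sum-positive (λ k → f (fs k)) 1≤Σf in fs i , 1≤fi

  sum-single : ∀ {n} (f : Fin n → ℕ) (y : Fin n) → (∀ x → y ≢ x → f x ≡ 0) → sum f ≡ f y
  sum-single f fz     vanish = trans (cong (f fz +_) (sum-zero _ (λ x → vanish (fs x) (λ ())))) (+-identityʳ (f fz))
  sum-single f (fs y) vanish =
    cong₂ _+_ (vanish fz (λ ())) (sum-single (f ∘ fs) y (λ x y≢x → vanish (fs x) (y≢x ∘ fsuc-injective)))

  sum-δ : ∀ {n} (y : Fin n) (g : Fin n → ℕ) → ∑[ x < n ] (⟦ y == x ⟧ * g x) ≡ g y
  sum-δ y g = begin
    sum (λ x → ⟦ y == x ⟧ * g x)  ≡⟨ sum-single _ y (λ x y≢x → cong (λ b → ⟦ b ⟧ * g x) (==-false y≢x)) ⟩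
    ⟦ y == y ⟧ * g y             ≡⟨ cong (λ b → ⟦ b ⟧ * g y) (==-refl y) ⟩
    g y + 0                      ≡⟨ +-identityʳ (g y) ⟩
    g y                          ∎
    where open ≡-Reasoning

  sum-== : ∀ {n} (x : Fin n) → ∑[ i < n ] ⟦ x == i ⟧ ≡ 1
  sum-== x = trans (sum-cong-≗ (λ i → sym (*-identityʳ ⟦ x == i ⟧))) (sum-δ x (λ _ → 1))

  sum-==ʳ : ∀ {n} (x : Fin n) → ∑[ i < n ] ⟦ i == x ⟧ ≡ 1
  sum-==ʳ x = trans (sum-cong-≗ (λ i → cong ⟦_⟧ (==-sym i x))) (sum-== x)

  sum²-term : ∀ {m n} (f : Fin m → Fin n → ℕ) i j → f i j ≤ ∑[ i < m ] ∑[ j < n ] f i j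
  sum²-term f i j = ≤-trans (sum-term (f i) j) (sum-term (λ i → sum (f i)) i)

  *-distribˡ-sum² : ∀ {m n} c (f : Fin m → Fin n → ℕ) →
    c * ∑[ i < m ] ∑[ j < n ] f i j ≡ ∑[ i < m ] ∑[ j < n ] (c * f i j)
  *-distribˡ-sum² c f = trans (*-distribˡ-sum c (λ i → sum (f i))) (sum-cong-≗ (λ i → *-distribˡ-sum c (f i)))

  sum-sum²-comm : ∀ {a c d} (f : Fin a → Fin c → Fin d → ℕ) →
    ∑[ x < a ] ∑[ i < c ] ∑[ j < d ] f x i j ≡ ∑[ i < c ] ∑[ j < d ] ∑[ x < a ] f x i j
  sum-sum²-comm f = trans (∑-comm (λ x i → sum (f x i))) (sum-cong-≗ (λ i → ∑-comm (λ x j → f x i j)))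

  sum²-comm : ∀ {a b c d} (f : Fin a → Fin b → Fin c → Fin d → ℕ) →
    ∑[ x < a ] ∑[ y < b ] ∑[ i < c ] ∑[ j < d ] f x y i j ≡ ∑[ i < c ] ∑[ j < d ] ∑[ x < a ] ∑[ y < b ] f x y i j
  sum²-comm f = trans (sum-cong-≗ (λ x → sum-sum²-comm (f x))) (sum-sum²-comm (λ x i j → sum (λ y → f x y i j)))

  sum²-permute : ∀ {n} (σ : Permutation′ n) (f : Fin n → Fin n → ℕ) →
    ∑[ i < n ] ∑[ j < n ] f (σ ⟨$⟩ʳ i) (σ ⟨$⟩ʳ j) ≡ ∑[ i < n ] ∑[ j < n ] f i j
  sum²-permute σ f = trans (sum-cong-≗ (λ i → sym (∑-permute (f (σ ⟨$⟩ʳ i)) σ)))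
                           (sym (∑-permute (λ i → sum (f i)) σ))

  count≡sum : ∀ {n} (p : Fin n → Bool) → count p ≡ ∑[ i < n ] ⟦ p i ⟧
  count≡sum p = sumFin≡sum (λ i → ⟦ p i ⟧)

  count-pair : ∀ {n} {y z : Fin n} → y ≢ z → count (λ i → (y == i) ∨ (z == i)) ≡ 2
  count-pair {n} {y} {z} y≢z = begin
    count (λ i → (y == i) ∨ (z == i))            ≡⟨ count≡sum (λ i → (y == i) ∨ (z == i)) ⟩
    ∑[ i < n ] ⟦ (y == i) ∨ (z == i) ⟧           ≡⟨ sum-cong-≗ (λ i → ⟦∨⟧-disjoint (y == i) (z == i) (disjoint i)) ⟩
    ∑[ i < n ] (⟦ y == i ⟧ + ⟦ z == i ⟧)         ≡⟨ ∑-distrib-+ (λ i → ⟦ y == i ⟧) (λ i → ⟦ z == i ⟧) ⟩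
    ∑[ i < n ] ⟦ y == i ⟧ + ∑[ i < n ] ⟦ z == i ⟧ ≡⟨ cong₂ _+_ (sum-== y) (sum-== z) ⟩
    2                                            ∎
    where
    open ≡-Reasoning
    disjoint : ∀ i → (y == i) ∧ (z == i) ≡ false
    disjoint i with y ≟ᶠ i | z ≟ᶠ i
    ... | yes refl | yes refl = ⊥-elim (y≢z refl)
    ... | yes _    | no _     = refl
    ... | no _     | _        = refl

  2≤count : ∀ {n} (A : Fin n → Bool) {u w : Fin n} → u ≢ w → A u ≡ true → A w ≡ true → 2 ≤ count A
  2≤count A {u} {w} u≢w Au Aw = subst₂ (λ a b → ⟦ a ⟧ + ⟦ b ⟧ ≤ count A) Au Aw
    (≤-trans (sum-two (⟦_⟧ ∘ A) u w u≢w) (≤-reflexive (sym (count≡sum A))))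

  3≤count : ∀ {n} (A : Fin n → Bool) {u w p : Fin n} → u ≢ w → p ≢ u → p ≢ w →
    A u ≡ true → A w ≡ true → A p ≡ true → 3 ≤ count A
  3≤count {n} A {u} {w} {p} u≢w p≢u p≢w Au Aw Ap = begin
    3
      ≡⟨ cong₂ _+_ (sum-== u) (cong₂ _+_ (sum-== w) (sum-== p)) ⟨
    ∑[ i < n ] ⟦ u == i ⟧ + (∑[ i < n ] ⟦ w == i ⟧ + ∑[ i < n ] ⟦ p == i ⟧)
      ≡⟨ cong (∑[ i < n ] ⟦ u == i ⟧ +_) (∑-distrib-+ (λ i → ⟦ w == i ⟧) (λ i → ⟦ p == i ⟧)) ⟨
    ∑[ i < n ] ⟦ u == i ⟧ + ∑[ i < n ] (⟦ w == i ⟧ + ⟦ p == i ⟧)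
      ≡⟨ ∑-distrib-+ (λ i → ⟦ u == i ⟧) (λ i → ⟦ w == i ⟧ + ⟦ p == i ⟧) ⟨
    ∑[ i < n ] (⟦ u == i ⟧ + (⟦ w == i ⟧ + ⟦ p == i ⟧))
      ≤⟨ sum-mono point ⟩
    ∑[ i < n ] ⟦ A i ⟧
      ≡⟨ count≡sum A ⟨
    count A ∎
    where
    open ≤-Reasoning
    point : ∀ i → ⟦ u == i ⟧ + (⟦ w == i ⟧ + ⟦ p == i ⟧) ≤ ⟦ A i ⟧
    point i with u ≟ᶠ i | w ≟ᶠ i | p ≟ᶠ i
    ... | yes refl | no _     | no _     rewrite Au = ≤-refl
    ... | no _     | yes refl | no _     rewrite Aw = ≤-refl
    ... | no _     | no _     | yes refl rewrite Ap = ≤-refl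
    ... | no _     | no _     | no _     = z≤n
    ... | yes refl | yes refl | _        = ⊥-elim (u≢w refl)
    ... | yes refl | no _     | yes refl = ⊥-elim (p≢u refl)
    ... | no _     | yes refl | yes refl = ⊥-elim (p≢w refl)

  fibreSum : ∀ {h N} → (Fin h → Fin N) → (Fin h → ℕ) → Fin N → ℕ
  fibreSum ψ T x = sum (λ a → ⟦ ψ a == x ⟧ * T a)

  ⟦==-refl⟧* : ∀ {n} (x : Fin n) t → ⟦ x == x ⟧ * t ≡ t
  ⟦==-refl⟧* x t = trans (cong (λ b → ⟦ b ⟧ * t) (==-refl x)) (+-identityʳ t)

  fibreSum-hit : ∀ {h N} (ψ : Fin h → Fin N) (T : Fin h → ℕ) a → 1 ≤ T a → 1 ≤ fibreSum ψ T (ψ a)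
  fibreSum-hit ψ T a 1≤Ta =
    ≤-trans 1≤Ta (subst (_≤ fibreSum ψ T (ψ a)) (⟦==-refl⟧* (ψ a) (T a)) (sum-term _ a))

  fibreSum-injective : ∀ {h N} {ψ : Fin h → Fin N} → Injective _≡_ _≡_ ψ →
    (T : Fin h → ℕ) {a₀ : Fin h} {x : Fin N} → ψ a₀ ≡ x → fibreSum ψ T x ≡ T a₀
  fibreSum-injective {ψ = ψ} ψ-inj T {a₀} refl =
    trans (sum-single _ a₀ (λ a a₀≢a → cong (λ b → ⟦ b ⟧ * T a) (==-false (a₀≢a ∘ sym ∘ ψ-inj))))
          (⟦==-refl⟧* (ψ a₀) (T a₀))

  sum-weighted-fibres : ∀ {h N} (ψ : Fin h → Fin N) (w : Fin N → ℕ) (T : Fin h → ℕ) →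
    ∑[ x < N ] (w x * fibreSum ψ T x) ≡ ∑[ a < h ] (w (ψ a) * T a)
  sum-weighted-fibres {h} {N} ψ w T = begin
    ∑[ x < N ] (w x * fibreSum ψ T x)
      ≡⟨ sum-cong-≗ (λ x → *-distribˡ-sum (w x) (λ a → ⟦ ψ a == x ⟧ * T a)) ⟩
    ∑[ x < N ] ∑[ a < h ] (w x * (⟦ ψ a == x ⟧ * T a))
      ≡⟨ ∑-comm (λ x a → w x * (⟦ ψ a == x ⟧ * T a)) ⟩
    ∑[ a < h ] ∑[ x < N ] (w x * (⟦ ψ a == x ⟧ * T a))
      ≡⟨ sum-cong-≗ (λ a → sum-cong-≗ (move-weight a)) ⟩
    ∑[ a < h ] ∑[ x < N ] (⟦ ψ a == x ⟧ * (w (ψ a) * T a))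
      ≡⟨ sum-cong-≗ (λ a → sum-δ (ψ a) _) ⟩
    ∑[ a < h ] (w (ψ a) * T a) ∎
    where
    open ≡-Reasoning
    move-weight : ∀ a x → w x * (⟦ ψ a == x ⟧ * T a) ≡ ⟦ ψ a == x ⟧ * (w (ψ a) * T a)
    move-weight a x with ψ a ≟ᶠ x
    ... | yes refl = trans (cong (w x *_) (+-identityʳ (T a))) (sym (+-identityʳ _))
    ... | no _     = *-zeroʳ (w x)

  sum-fibres : ∀ {h N} (ψ : Fin h → Fin N) (T : Fin h → ℕ) → ∑[ x < N ] fibreSum ψ T x ≡ sum T
  sum-fibres ψ T = begin
    sum (fibreSum ψ T)                ≡⟨ sum-cong-≗ (λ x → sym (*-identityˡ (fibreSum ψ T x))) ⟩
    sum (λ x → 1 * fibreSum ψ T x)    ≡⟨ sum-weighted-fibres ψ (λ _ → 1) T ⟩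
    sum (λ a → 1 * T a)               ≡⟨ sum-cong-≗ (λ a → *-identityˡ (T a)) ⟩
    sum T                             ∎
    where open ≡-Reasoning

  sum-fibres² : ∀ {h N} (ψ : Fin h → Fin N) (T : Fin h → Fin h → ℕ) →
    ∑[ x < N ] ∑[ y < N ] fibreSum ψ (λ a → fibreSum ψ (T a) y) x ≡ ∑[ a < h ] ∑[ b < h ] T a b
  sum-fibres² {h} {N} ψ T = begin
    ∑[ x < N ] ∑[ y < N ] fibreSum ψ (λ a → fibreSum ψ (T a) y) x
      ≡⟨ ∑-comm (λ x y → fibreSum ψ (λ a → fibreSum ψ (T a) y) x) ⟩
    ∑[ y < N ] ∑[ x < N ] fibreSum ψ (λ a → fibreSum ψ (T a) y) x
      ≡⟨ sum-cong-≗ (λ y → sum-fibres ψ (λ a → fibreSum ψ (T a) y)) ⟩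
    ∑[ y < N ] ∑[ a < h ] fibreSum ψ (T a) y
      ≡⟨ ∑-comm (λ y a → fibreSum ψ (T a) y) ⟩
    ∑[ a < h ] ∑[ y < N ] fibreSum ψ (T a) y
      ≡⟨ sum-cong-≗ (λ a → sum-fibres ψ (T a)) ⟩
    ∑[ a < h ] ∑[ b < h ] T a b ∎
    where open ≡-Reasoning

  lt : ∀ {n} → Fin n → Fin n → Bool
  lt i j = does (toℕ i <? toℕ j)

  countPairs≡sum : ∀ {n} (r : Fin n → Fin n → Bool) → countPairs r ≡ ∑[ i < n ] ∑[ j < n ] ⟦ lt i j ∧ r i j ⟧
  countPairs≡sum r = trans (sumFin≡sum (λ i → sumFin (λ j → ⟦ lt i j ∧ r i j ⟧)))
                           (sum-cong-≗ (λ i → sumFin≡sum (λ j → ⟦ lt i j ∧ r i j ⟧)))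

  countPairs-empty : ∀ {n} (r : Fin n → Fin n → Bool) → (∀ p q → r p q ≡ false) → countPairs r ≡ 0
  countPairs-empty r r≡false = trans (countPairs≡sum r) (sum-zero _ (λ p → sum-zero _ (λ q →
    trans (cong (λ b → ⟦ lt p q ∧ b ⟧) (r≡false p q)) (cong ⟦_⟧ (∧-zeroʳ (lt p q))))))

  Symmetric Irreflexive : ∀ {n} → (Fin n → Fin n → Bool) → Set
  Symmetric r = ∀ i j → r i j ≡ r j i
  Irreflexive r = ∀ i → r i i ≡ false

  double-countPairs : ∀ {n} (r : Fin n → Fin n → Bool) → Symmetric r → Irreflexive r →
    ∑[ i < n ] ∑[ j < n ] ⟦ r i j ⟧ ≡ 2 * countPairs r
  double-countPairs {n} r r-sym r-irr = begin
    ∑[ i < n ] ∑[ j < n ] ⟦ r i j ⟧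
      ≡⟨ sum-cong-≗ (λ i → sum-cong-≗ (split i)) ⟩
    ∑[ i < n ] ∑[ j < n ] (⟦ lt i j ∧ r i j ⟧ + ⟦ lt j i ∧ r j i ⟧)
      ≡⟨ sum-cong-≗ (λ i → ∑-distrib-+ (λ j → ⟦ lt i j ∧ r i j ⟧) (λ j → ⟦ lt j i ∧ r j i ⟧)) ⟩
    ∑[ i < n ] (∑[ j < n ] ⟦ lt i j ∧ r i j ⟧ + ∑[ j < n ] ⟦ lt j i ∧ r j i ⟧)
      ≡⟨ ∑-distrib-+ (λ i → ∑[ j < n ] ⟦ lt i j ∧ r i j ⟧) (λ i → ∑[ j < n ] ⟦ lt j i ∧ r j i ⟧) ⟩
    P + ∑[ i < n ] ∑[ j < n ] ⟦ lt j i ∧ r j i ⟧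
      ≡⟨ cong (P +_) (∑-comm (λ i j → ⟦ lt j i ∧ r j i ⟧)) ⟩
    P + P
      ≡⟨ cong (λ t → t + t) (countPairs≡sum r) ⟨
    countPairs r + countPairs r
      ≡⟨ cong (countPairs r +_) (+-identityʳ (countPairs r)) ⟨
    2 * countPairs r ∎
    where
    open ≡-Reasoning
    P : ℕ
    P = ∑[ i < n ] ∑[ j < n ] ⟦ lt i j ∧ r i j ⟧
    split : ∀ i j → ⟦ r i j ⟧ ≡ ⟦ lt i j ∧ r i j ⟧ + ⟦ lt j i ∧ r j i ⟧
    split i j with <-cmp (toℕ i) (toℕ j)
    ... | tri< i<j _ j≮i rewrite dec-true (toℕ i <? toℕ j) i<j | dec-false (toℕ j <? toℕ i) j≮i =
      sym (+-identityʳ _)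
    ... | tri> i≮j _ j<i rewrite dec-false (toℕ i <? toℕ j) i≮j | dec-true (toℕ j <? toℕ i) j<i | r-sym i j =
      refl
    ... | tri≈ i≮j i≡j _ rewrite toℕ-injective i≡j | r-irr j | dec-false (toℕ j <? toℕ j) i≮j = refl

module RationalBounds where

  open FiniteSums using (⟦_⟧; sum)
  open import Data.Nat as ℕ using (ℕ; zero; suc)
  import Data.Nat.Properties as ℕ
  import Data.Nat.Solver
  open import Data.Integer as ℤ using (ℤ; +_; +[1+_]; -[1+_])
  import Data.Integer.Properties as ℤ
  open import Data.Integer.Tactic.RingSolver using (solve-∀)
  open import Data.Rational
    using (ℚ; toℚᵘ; mkℚ; 0ℚ; 1ℚ; _≤_; _<_; _+_; _*_; -_; _-_; 1/_; NonZero; nonNegative; ≢-nonZero)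
  open import Data.Rational.Properties
  open import Data.Rational.Solver using (module +-*-Solver)
  open import Data.Rational.Unnormalised as ℚᵘ using (mkℚᵘ; *≡*; *≤*)
  import Data.Rational.Unnormalised.Properties as ℚᵘ

  private
    ι : ℤ → ℚᵘ.ℚᵘ
    ι z = mkℚᵘ z 0

    toℚᵘ-ℤ→ℚ : ∀ z → toℚᵘ (ℤ→ℚ z) ℚᵘ.≃ ι z
    toℚᵘ-ℤ→ℚ z = toℚᵘ-fromℚᵘ (ι z)

  ℤ→ℚ-+ : ∀ x y → ℤ→ℚ (x ℤ.+ y) ≡ ℤ→ℚ x + ℤ→ℚ y
  ℤ→ℚ-+ x y = toℚᵘ-injective (begin
    toℚᵘ (ℤ→ℚ (x ℤ.+ y))                ≈⟨ toℚᵘ-ℤ→ℚ (x ℤ.+ y) ⟩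
    ι (x ℤ.+ y)                         ≈⟨ *≡* (cong (ℤ._* + 1) (cong₂ ℤ._+_ (ℤ.*-identityʳ x) (ℤ.*-identityʳ y))) ⟨
    ι x ℚᵘ.+ ι y                        ≈⟨ ℚᵘ.+-cong (toℚᵘ-ℤ→ℚ x) (toℚᵘ-ℤ→ℚ y) ⟨
    toℚᵘ (ℤ→ℚ x) ℚᵘ.+ toℚᵘ (ℤ→ℚ y)      ≈⟨ toℚᵘ-homo-+ (ℤ→ℚ x) (ℤ→ℚ y) ⟨
    toℚᵘ (ℤ→ℚ x + ℤ→ℚ y)                ∎)
    where open ℚᵘ.≃-Reasoning

  ℤ→ℚ-neg : ∀ x → ℤ→ℚ (ℤ.- x) ≡ - ℤ→ℚ x
  ℤ→ℚ-neg x = toℚᵘ-injective (ℚᵘ.≃-trans (toℚᵘ-ℤ→ℚ (ℤ.- x))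
    (ℚᵘ.≃-trans (ℚᵘ.-‿cong (ℚᵘ.≃-sym (toℚᵘ-ℤ→ℚ x))) (ℚᵘ.≃-sym (toℚᵘ-homo‿- (ℤ→ℚ x)))))

  ℤ→ℚ-minus : ∀ x y → ℤ→ℚ (x ℤ.- y) ≡ ℤ→ℚ x - ℤ→ℚ y
  ℤ→ℚ-minus x y = trans (ℤ→ℚ-+ x (ℤ.- y)) (cong (λ t → ℤ→ℚ x + t) (ℤ→ℚ-neg y))

  ℤ→ℚ-mono-≤ : ∀ {x y} → x ℤ.≤ y → ℤ→ℚ x ≤ ℤ→ℚ y
  ℤ→ℚ-mono-≤ {x} {y} x≤y = toℚᵘ-cancel-≤
    (ℚᵘ.≤-respˡ-≃ (ℚᵘ.≃-sym (toℚᵘ-ℤ→ℚ x)) (ℚᵘ.≤-respʳ-≃ (ℚᵘ.≃-sym (toℚᵘ-ℤ→ℚ y))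
      (*≤* (subst₂ ℤ._≤_ (sym (ℤ.*-identityʳ x)) (sym (ℤ.*-identityʳ y)) x≤y))))

  ℕ→ℚ-+ : ∀ a b → ℕ→ℚ (a ℕ.+ b) ≡ ℕ→ℚ a + ℕ→ℚ b
  ℕ→ℚ-+ a b = trans (cong ℤ→ℚ (ℤ.pos-+ a b)) (ℤ→ℚ-+ (+ a) (+ b))

  ℕ→ℚ-mono-≤ : ∀ {a b} → a ℕ.≤ b → ℕ→ℚ a ≤ ℕ→ℚ b
  ℕ→ℚ-mono-≤ a≤b = ℤ→ℚ-mono-≤ (ℤ.+≤+ a≤b)

  ℕ→ℚ-nonNeg : ∀ a → 0ℚ ≤ ℕ→ℚ a
  ℕ→ℚ-nonNeg a = ℕ→ℚ-mono-≤ {0} {a} ℕ.z≤n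

  ℤ→ℚ-∸ : ∀ {a b} → b ℕ.≤ a → ℤ→ℚ (+ a ℤ.- + b) ≡ ℕ→ℚ (a ℕ.∸ b)
  ℤ→ℚ-∸ {a} {b} b≤a = cong ℤ→ℚ (trans (ℤ.m-n≡m⊖n a b) (ℤ.⊖-≥ b≤a))

  /-*-cancel : ∀ a k → (+ a Data.Rational./ suc k) * ℕ→ℚ (suc k) ≡ ℕ→ℚ a
  /-*-cancel a k = toℚᵘ-injective (ℚᵘ.≃-trans (toℚᵘ-homo-* (+ a Data.Rational./ suc k) (ℕ→ℚ (suc k)))
    (ℚᵘ.≃-trans (ℚᵘ.*-cong (toℚᵘ-fromℚᵘ (mkℚᵘ (+ a) k)) (toℚᵘ-ℤ→ℚ (+ suc k)))
    (ℚᵘ.≃-trans (*≡* eq) (ℚᵘ.≃-sym (toℚᵘ-ℤ→ℚ (+ a))))))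
    where
    eq : (+ a ℤ.* + suc k) ℤ.* + 1 ≡ + a ℤ.* + suc (k ℕ.* 1)
    eq rewrite ℕ.*-identityʳ k = ℤ.*-identityʳ _

  *-nonNeg : ∀ {p q} → 0ℚ ≤ p → 0ℚ ≤ q → 0ℚ ≤ p * q
  *-nonNeg {p} 0≤p 0≤q = ≤-trans (≤-reflexive (sym (*-zeroʳ p))) (*-monoˡ-≤-nonNeg p {{nonNegative 0≤p}} 0≤q)

  1/-pos : ∀ m .{{_ : NonZero m}} → 0ℚ ≤ m → 0ℚ < 1/ m
  1/-pos (mkℚ +[1+ n ] d _) _   = positive⁻¹ (mkℚ +[1+ d ] n _)
  1/-pos m@(mkℚ -[1+ _ ] _ _) 0≤m = ⊥-elim (<-irrefl refl (≤-<-trans 0≤m (negative⁻¹ m)))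

  ÷₀-≤ : ∀ {p m X} → 0ℚ ≤ m → 0ℚ ≤ X → p ≤ m * X → p ÷₀ m ≤ X
  ÷₀-≤ {p} {m} {X} 0≤m 0≤X p≤mX with m ≟ 0ℚ
  ... | yes _   = 0≤X
  ... | no m≢0 = begin
    p * 1/ m           ≤⟨ *-monoʳ-≤-nonNeg (1/ m) {{nonNegative (<⇒≤ (1/-pos m 0≤m))}} p≤mX ⟩
    m * X * 1/ m       ≡⟨ cong (_* 1/ m) (*-comm m X) ⟩
    X * m * 1/ m       ≡⟨ *-assoc X m (1/ m) ⟩
    X * (m * 1/ m)     ≡⟨ cong (X *_) (*-inverseʳ m) ⟩
    X * 1ℚ             ≡⟨ *-identityʳ X ⟩
    X                  ∎
    where
    open ≤-Reasoning
    instance _ = ≢-nonZero m≢0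

  ≤-*-of-÷₀-≤ : ∀ {p D m} → 0ℚ < D → p ÷₀ D ≤ m → p ≤ m * D
  ≤-*-of-÷₀-≤ {p} {D} {m} 0<D p÷D≤m with D ≟ 0ℚ
  ... | yes refl = ⊥-elim (<-irrefl refl 0<D)
  ... | no D≢0  = begin
    p                  ≡⟨ *-identityʳ p ⟨
    p * 1ℚ             ≡⟨ cong (p *_) (*-inverseˡ D) ⟨
    p * (1/ D * D)     ≡⟨ *-assoc p (1/ D) D ⟨
    p * 1/ D * D       ≤⟨ *-monoʳ-≤-nonNeg D {{nonNegative (<⇒≤ 0<D)}} p÷D≤m ⟩
    m * D              ∎
    where
    open ≤-Reasoning
    instance _ = ≢-nonZero D≢0

  reciprocal-of-≥1 : ∀ {m} → 1ℚ ≤ m → (0ℚ < 1ℚ ÷₀ m) × (1ℚ ÷₀ m ≤ 1ℚ) × ((1ℚ ÷₀ m) * m ≡ 1ℚ)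
  reciprocal-of-≥1 {m} 1≤m with m ≟ 0ℚ
  ... | yes refl = ⊥-elim (<-irrefl refl (<-≤-trans (positive⁻¹ 1ℚ) 1≤m))
  ... | no m≢0  = 0<c , c≤1 , c*m≡1
    where
    instance _ = ≢-nonZero m≢0
    c : ℚ
    c = 1ℚ * 1/ m
    c*m≡1 : c * m ≡ 1ℚ
    c*m≡1 = trans (cong (_* m) (*-identityˡ (1/ m))) (*-inverseˡ m)
    0<c : 0ℚ < c
    0<c = subst (0ℚ <_) (sym (*-identityˡ (1/ m)))
            (1/-pos m (≤-trans (<⇒≤ (positive⁻¹ 1ℚ)) 1≤m))
    c≤1 : c ≤ 1ℚ
    c≤1 = begin
      c          ≡⟨ *-identityʳ c ⟨
      c * 1ℚ     ≤⟨ *-monoˡ-≤-nonNeg c {{nonNegative (<⇒≤ 0<c)}} 1≤m ⟩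
      c * m      ≡⟨ c*m≡1 ⟩
      1ℚ         ∎
      where open ≤-Reasoning

  interpolate : ∀ {c} (k y : ℕ) b → 0ℚ ≤ c → c ≤ 1ℚ → k ℕ.+ 1 ℕ.≤ y ℕ.+ ⟦ b ⟧ →
    ℕ→ℚ k + c ≤ ℕ→ℚ y + c * ℕ→ℚ ⟦ b ⟧
  interpolate {c} k y true  _   _   k+1≤y+1 = +-mono-≤
    (ℕ→ℚ-mono-≤ (ℕ.+-cancelʳ-≤ 1 k y k+1≤y+1)) (≤-reflexive (sym (*-identityʳ c)))
  interpolate {c} k y false 0≤c c≤1 k+1≤y+0 = begin
    ℕ→ℚ k + c              ≤⟨ +-monoʳ-≤ (ℕ→ℚ k) c≤1 ⟩
    ℕ→ℚ k + ℕ→ℚ 1          ≡⟨ ℕ→ℚ-+ k 1 ⟨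
    ℕ→ℚ (k ℕ.+ 1)          ≤⟨ ℕ→ℚ-mono-≤ (subst (k ℕ.+ 1 ℕ.≤_) (ℕ.+-identityʳ y) k+1≤y+0) ⟩
    ℕ→ℚ y                  ≡⟨ +-identityʳ (ℕ→ℚ y) ⟨
    ℕ→ℚ y + 0ℚ             ≡⟨ cong (λ t → ℕ→ℚ y + t) (*-zeroʳ c) ⟨
    ℕ→ℚ y + c * ℕ→ℚ 0      ∎
    where open ≤-Reasoning

  ⟦⟧+⟦⟧≤1+⟦∧⟧ : ∀ a b → ⟦ a ⟧ ℕ.+ ⟦ b ⟧ ℕ.≤ suc ⟦ a ∧ b ⟧
  ⟦⟧+⟦⟧≤1+⟦∧⟧ true  true  = ℕ.≤-refl
  ⟦⟧+⟦⟧≤1+⟦∧⟧ true  false = ℕ.s≤s ℕ.z≤n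
  ⟦⟧+⟦⟧≤1+⟦∧⟧ false true  = ℕ.≤-refl
  ⟦⟧+⟦⟧≤1+⟦∧⟧ false false = ℕ.z≤n

  copy-vertices-bound : ∀ v y b₁ b₂ → 2 ℕ.≤ v → v ℕ.≤ y ℕ.+ (⟦ b₁ ⟧ ℕ.+ ⟦ b₂ ⟧) →
    (v ℕ.∸ 2) ℕ.+ 1 ℕ.≤ y ℕ.+ ⟦ b₁ ∧ b₂ ⟧
  copy-vertices-bound (suc (suc v′)) y b₁ b₂ _ v≤ = subst (ℕ._≤ y ℕ.+ ⟦ b₁ ∧ b₂ ⟧) (ℕ.+-comm 1 v′)
    (ℕ.s≤s⁻¹ (ℕ.≤-trans v≤ (ℕ.≤-trans (ℕ.+-monoʳ-≤ y (⟦⟧+⟦⟧≤1+⟦∧⟧ b₁ b₂))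
                                        (ℕ.≤-reflexive (ℕ.+-suc y _)))))
  copy-vertices-bound (suc zero) y b₁ b₂ (ℕ.s≤s ()) _

  affine-nonNeg : ∀ {m c} y b → 0ℚ ≤ m → 0ℚ ≤ c → 0ℚ ≤ m * (ℕ→ℚ y + c * ℕ→ℚ b)
  affine-nonNeg y b 0≤m 0≤c = *-nonNeg 0≤m (+-mono-≤ (ℕ→ℚ-nonNeg y) (*-nonNeg 0≤c (ℕ→ℚ-nonNeg b)))

  copy-edge-bound : ∀ {E mG m} e v y b₁ b₂ → 0ℚ ≤ m → 0ℚ < 1ℚ ÷₀ mG → 1ℚ ÷₀ mG ≤ 1ℚ →
    (1 ℕ.≤ e → 2 ℕ.≤ v) → v ℕ.≤ y ℕ.+ (⟦ b₁ ⟧ ℕ.+ ⟦ b₂ ⟧) → d₂′ (suc E) mG v e ≤ m →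
    ℕ→ℚ e ≤ m * (ℕ→ℚ y + (1ℚ ÷₀ mG) * ℕ→ℚ ⟦ b₁ ∧ b₂ ⟧)
  copy-edge-bound zero v y b₁ b₂ 0≤m 0<c _ _ _ _ = affine-nonNeg y ⟦ b₁ ∧ b₂ ⟧ 0≤m (<⇒≤ 0<c)
  copy-edge-bound {mG = mG} {m} (suc k) v y b₁ b₂ 0≤m 0<c c≤1 2≤v v≤ d₂≤m = begin
    ℕ→ℚ (suc k)    ≤⟨ ≤-*-of-÷₀-≤ 0<D (subst (λ D → ℕ→ℚ (suc k) ÷₀ D ≤ m) D≡ d₂≤m) ⟩
    m * D          ≤⟨ *-monoˡ-≤-nonNeg m {{nonNegative 0≤m}}
                        (interpolate (v ℕ.∸ 2) y (b₁ ∧ b₂) (<⇒≤ 0<c) c≤1 (copy-vertices-bound v y b₁ b₂ v≥2 v≤)) ⟩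
    m * (ℕ→ℚ y + c * ℕ→ℚ ⟦ b₁ ∧ b₂ ⟧) ∎
    where
    open ≤-Reasoning
    c : ℚ
    c = 1ℚ ÷₀ mG
    v≥2 : 2 ℕ.≤ v
    v≥2 = 2≤v (ℕ.s≤s ℕ.z≤n)
    D : ℚ
    D = ℕ→ℚ (v ℕ.∸ 2) + c
    D≡ : ℤ→ℚ (+ v ℤ.- + 2) + c ≡ D
    D≡ = cong (_+ c) (ℤ→ℚ-∸ v≥2)
    0<D : 0ℚ < D
    0<D = ≤-<-trans (ℕ→ℚ-nonNeg (v ℕ.∸ 2)) (subst (_< D) (+-identityʳ _) (+-monoʳ-< (ℕ→ℚ (v ℕ.∸ 2)) 0<c))

  ℕ→ℚ-sum-≤ : ∀ {n} (f g h : Fin n → ℕ) {m c} →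
    (∀ i → ℕ→ℚ (f i) ≤ m * (ℕ→ℚ (g i) + c * ℕ→ℚ (h i))) →
    ℕ→ℚ (sum f) ≤ m * (ℕ→ℚ (sum g) + c * ℕ→ℚ (sum h))
  ℕ→ℚ-sum-≤ {zero}  f g h {m} {c} _ = ≤-reflexive (sym (begin-equality
    m * (0ℚ + c * 0ℚ)   ≡⟨ cong (λ t → m * (0ℚ + t)) (*-zeroʳ c) ⟩
    m * (0ℚ + 0ℚ)       ≡⟨ *-zeroʳ m ⟩
    0ℚ                  ∎))
    where open ≤-Reasoning
  ℕ→ℚ-sum-≤ {suc n} f g h {m} {c} f≤ = begin
    ℕ→ℚ (f fz ℕ.+ sum (f ∘ fs))
      ≡⟨ ℕ→ℚ-+ (f fz) (sum (f ∘ fs)) ⟩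
    ℕ→ℚ (f fz) + ℕ→ℚ (sum (f ∘ fs))
      ≤⟨ +-mono-≤ (f≤ fz) (ℕ→ℚ-sum-≤ (f ∘ fs) (g ∘ fs) (h ∘ fs) {m} {c} (f≤ ∘ fs)) ⟩
    m * (g₀ + c * h₀) + m * (G + c * H)
      ≡⟨ distrib g₀ h₀ G H m c ⟩
    m * ((g₀ + G) + c * (h₀ + H))
      ≡⟨ cong₂ (λ a b → m * (a + c * b)) (ℕ→ℚ-+ (g fz) _) (ℕ→ℚ-+ (h fz) _) ⟨
    m * (ℕ→ℚ (g fz ℕ.+ sum (g ∘ fs)) + c * ℕ→ℚ (h fz ℕ.+ sum (h ∘ fs))) ∎
    where
    open ≤-Reasoning
    g₀ h₀ G H : ℚ
    g₀ = ℕ→ℚ (g fz)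
    h₀ = ℕ→ℚ (h fz)
    G = ℕ→ℚ (sum (g ∘ fs))
    H = ℕ→ℚ (sum (h ∘ fs))
    distrib : ∀ g₀ h₀ G H m c → m * (g₀ + c * h₀) + m * (G + c * H) ≡ m * ((g₀ + G) + c * (h₀ + H))
    distrib = solve 6 (λ g₀ h₀ G H m c →
      m :* (g₀ :+ c :* h₀) :+ m :* (G :+ c :* H) := m :* ((g₀ :+ G) :+ c :* (h₀ :+ H))) refl
      where open +-*-Solver

  d₂-reciprocal-bound : ∀ {mG c} k ε → 0ℚ ≤ c → c * mG ≡ 1ℚ → d₂ (3 ℕ.+ k) (suc ε) ≤ mG →
    c * ℕ→ℚ ε ≤ ℕ→ℚ (suc k)
  d₂-reciprocal-bound {mG} {c} k ε 0≤c c*mG≡1 d₂≤mG = begin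
    c * ℕ→ℚ ε                         ≡⟨ cong (c *_) (/-*-cancel ε k) ⟨
    c * ((+ ε Data.Rational./ suc k) * s) ≤⟨ *-monoˡ-≤-nonNeg c {{nonNegative 0≤c}}
                                             (*-monoʳ-≤-nonNeg s {{nonNegative (ℕ→ℚ-nonNeg (suc k))}} d₂≤mG) ⟩
    c * (mG * s)                      ≡⟨ *-assoc c mG s ⟨
    c * mG * s                        ≡⟨ cong (_* s) c*mG≡1 ⟩
    1ℚ * s                            ≡⟨ *-identityˡ s ⟩
    s                                 ∎
    where
    open ≤-Reasoning
    s : ℚ
    s = ℕ→ℚ (suc k)

  2-[n+P-N]≡vJ-X : ∀ vJ X n N P → X ℕ.+ (N ℕ.+ 2) ≡ vJ ℕ.+ (n ℕ.+ P) →
    + 2 ℤ.- (+ n ℤ.+ + P ℤ.- + N) ≡ + vJ ℤ.- + X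
  2-[n+P-N]≡vJ-X vJ X n N P eq = begin
    + 2 ℤ.- (+ n ℤ.+ + P ℤ.- + N)                       ≡⟨ expand (+ X) (+ N) (+ n) (+ P) ⟩
    (+ X ℤ.+ (+ N ℤ.+ + 2)) ℤ.- (+ n ℤ.+ + P) ℤ.- + X   ≡⟨ cong (λ t → t ℤ.- (+ n ℤ.+ + P) ℤ.- + X) sides ⟩
    (+ vJ ℤ.+ (+ n ℤ.+ + P)) ℤ.- (+ n ℤ.+ + P) ℤ.- + X  ≡⟨ cancel (+ vJ) (+ n ℤ.+ + P) (+ X) ⟩
    + vJ ℤ.- + X                                        ∎
    where
    open ≡-Reasoning
    expand : ∀ x N n P → + 2 ℤ.- (n ℤ.+ P ℤ.- N) ≡ (x ℤ.+ (N ℤ.+ + 2)) ℤ.- (n ℤ.+ P) ℤ.- x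
    expand = solve-∀
    cancel : ∀ v s x → (v ℤ.+ s) ℤ.- s ℤ.- x ≡ v ℤ.- x
    cancel = solve-∀
    sides : + X ℤ.+ (+ N ℤ.+ + 2) ≡ + vJ ℤ.+ (+ n ℤ.+ + P)
    sides = begin
      + X ℤ.+ (+ N ℤ.+ + 2)       ≡⟨ ℤ.pos-+ X (N ℕ.+ 2) ⟨
      + (X ℕ.+ (N ℕ.+ 2))         ≡⟨ cong +_ eq ⟩
      + (vJ ℕ.+ (n ℕ.+ P))        ≡⟨ ℤ.pos-+ vJ (n ℕ.+ P) ⟩
      + vJ ℤ.+ (+ n ℤ.+ + P)      ∎

  final-bound : ∀ {m c L} (vJ eJ a y ε n N P : ℕ) → 0ℚ ≤ m →
    ℕ→ℚ eJ ≤ m * (ℕ→ℚ y + c * ℕ→ℚ ε) → c * ℕ→ℚ ε ≤ ℕ→ℚ (a ℕ.∸ 2) → 2 ℕ.≤ a →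
    N ℕ.+ (a ℕ.+ y) ℕ.≤ vJ ℕ.+ (n ℕ.+ P) → L ≡ + n ℤ.+ + P ℤ.- + N →
    ℤ→ℚ (+ 2 ℤ.- L) ≤ ℕ→ℚ vJ - (ℕ→ℚ eJ ÷₀ m)
  final-bound {m} {c} vJ eJ a y ε n N P 0≤m eJ≤ cε≤ 2≤a count refl = begin
    ℤ→ℚ (+ 2 ℤ.- (+ n ℤ.+ + P ℤ.- + N))  ≡⟨ cong ℤ→ℚ (2-[n+P-N]≡vJ-X vJ X n N P X+[N+2]≡R) ⟩
    ℤ→ℚ (+ vJ ℤ.- + X)                   ≡⟨ ℤ→ℚ-minus (+ vJ) (+ X) ⟩
    ℕ→ℚ vJ - ℕ→ℚ X                      ≤⟨ +-monoʳ-≤ (ℕ→ℚ vJ) (neg-antimono-≤ (÷₀-≤ 0≤m (ℕ→ℚ-nonNeg X) eJ≤mX)) ⟩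
    ℕ→ℚ vJ - (ℕ→ℚ eJ ÷₀ m)             ∎
    where
    open ≤-Reasoning
    -- X = v(J) − 2 + L(G₋^H)
    R X : ℕ
    R = vJ ℕ.+ (n ℕ.+ P)
    X = R ℕ.∸ (N ℕ.+ 2)
    a≡ : (a ℕ.∸ 2) ℕ.+ 2 ≡ a
    a≡ = ℕ.m∸n+n≡m 2≤a
    y+[a-2]≤X : y ℕ.+ (a ℕ.∸ 2) ℕ.≤ X
    y+[a-2]≤X = ℕ.m+n≤o⇒m≤o∸n (y ℕ.+ (a ℕ.∸ 2)) (subst (ℕ._≤ R) (sym regroup) count)
      where
      regroup : (y ℕ.+ (a ℕ.∸ 2)) ℕ.+ (N ℕ.+ 2) ≡ N ℕ.+ (a ℕ.+ y)
      regroup = trans (solve 3 (λ y b N → (y :+ b) :+ (N :+ con 2) := N :+ ((b :+ con 2) :+ y)) refl y (a ℕ.∸ 2) N)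
                      (cong (λ t → N ℕ.+ (t ℕ.+ y)) a≡)
        where open Data.Nat.Solver.+-*-Solver
    X+[N+2]≡R : X ℕ.+ (N ℕ.+ 2) ≡ R
    X+[N+2]≡R = ℕ.m∸n+n≡m (ℕ.≤-trans (ℕ.+-monoʳ-≤ N (ℕ.≤-trans 2≤a (ℕ.m≤m+n a y))) count)
    eJ≤mX : ℕ→ℚ eJ ≤ m * ℕ→ℚ X
    eJ≤mX = begin
      ℕ→ℚ eJ                             ≤⟨ eJ≤ ⟩
      m * (ℕ→ℚ y + c * ℕ→ℚ ε)            ≤⟨ *-monoˡ-≤-nonNeg m {{nonNegative 0≤m}} (+-monoʳ-≤ (ℕ→ℚ y) cε≤) ⟩
      m * (ℕ→ℚ y + ℕ→ℚ (a ℕ.∸ 2))        ≡⟨ cong (m *_) (ℕ→ℚ-+ y (a ℕ.∸ 2)) ⟨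
      m * ℕ→ℚ (y ℕ.+ (a ℕ.∸ 2))          ≤⟨ *-monoˡ-≤-nonNeg m {{nonNegative 0≤m}} (ℕ→ℚ-mono-≤ y+[a-2]≤X) ⟩
      m * ℕ→ℚ X                          ∎

module Subgraphs where

  open FiniteSums
  open import Data.Nat using (ℕ; zero; suc; _+_; _*_; _≤_)
  open import Data.Nat.Properties
  import Data.Rational as ℚ
  open ℚ using (0ℚ; 1ℚ)

  es-irrefl : ∀ {n} {G : Graph n} (S : Subgraph G) → Irreflexive (es S)
  es-irrefl {G = G} S i with es S i i in eq
  ... | false = refl
  ... | true  = sym (trans (sym (adj-irr G i)) (es-adj S i i eq))

  double-eS : ∀ {n} {G : Graph n} (S : Subgraph G) → ∑[ i < n ] ∑[ j < n ] ⟦ es S i j ⟧ ≡ 2 * eS S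
  double-eS S = double-countPairs (es S) (es-sym S) (es-irrefl S)

  edge-of-positive-eS : ∀ {n} {G : Graph n} (S : Subgraph G) → 1 ≤ eS S →
    Σ (Fin n) λ i → Σ (Fin n) λ j → es S i j ≡ true
  edge-of-positive-eS S 1≤e =
    let i , 1≤Σ = sum-positive _ (≤-trans 1≤e (subst (eS S ≤_) (sym (double-eS S)) (m≤m+n _ _)))
        j , 1≤ij = sum-positive _ 1≤Σ
    in i , j , ⟦⟧-positive 1≤ij

  2≤vS-of-edge : ∀ {n} {G : Graph n} (S : Subgraph G) → 1 ≤ eS S → 2 ≤ vS S
  2≤vS-of-edge {n} S 1≤e with edge-of-positive-eS S 1≤e
  ... | i , j , ij∈S = begin
    2
      ≡⟨ cong₂ (λ a b → ⟦ a ⟧ + ⟦ b ⟧) (es-vs S i j ij∈S) (es-vs S j i (trans (es-sym S j i) ij∈S)) ⟨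
    ⟦ vs S i ⟧ + ⟦ vs S j ⟧
      ≤⟨ sum-two _ i j i≢j ⟩
    ∑[ k < n ] ⟦ vs S k ⟧
      ≡⟨ count≡sum (vs S) ⟨
    vS S ∎
    where
    open ≤-Reasoning
    i≢j : i ≢ j
    i≢j refl with trans (sym ij∈S) (es-irrefl S i)
    ... | ()

  matching-at? : ∀ {n} (G : Graph n) x y z → Dec (adj G x y ≡ true → adj G x z ≡ true → y ≡ z)
  matching-at? G x y z = (adj G x y Bool.≟ true) →-dec (adj G x z Bool.≟ true) →-dec (y ≟ᶠ z)

  cherry-of-¬IsMatching : ∀ {n} (G : Graph n) → ¬ IsMatching G →
    Σ (Fin n) λ x → Σ (Fin n) λ y → Σ (Fin n) λ z → adj G x y ≡ true × adj G x z ≡ true × y ≢ z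
  cherry-of-¬IsMatching {n} G ¬matching
    with x , ¬x ← ¬∀⟶∃¬ n _ (λ x → all? (λ y → all? (λ z → matching-at? G x y z))) ¬matching
    with y , ¬y ← ¬∀⟶∃¬ n _ (λ y → all? (λ z → matching-at? G x y z)) ¬x
    with z , ¬z ← ¬∀⟶∃¬ n _ (λ z → matching-at? G x y z) ¬y
    with adj G x y Bool.≟ true | adj G x z Bool.≟ true | y ≟ᶠ z
  ... | yes xy | yes xz | no y≢z = x , y , z , xy , xz , y≢z
  ... | no ¬xy | _      | _      = ⊥-elim (¬z (λ xy → ⊥-elim (¬xy xy)))
  ... | yes _  | no ¬xz | _      = ⊥-elim (¬z (λ _ xz → ⊥-elim (¬xz xz)))
  ... | yes _  | yes _  | yes y≡z = ⊥-elim (¬z (λ _ _ → y≡z))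

  module Star {n} (G : Graph n) (x : Fin n) (N : Fin n → Bool)
              (N⊆adj : ∀ j → N j ≡ true → adj G x j ≡ true) (x∉N : N x ≡ false) where

    spoke : Fin n → Fin n → Bool
    spoke i j = (x == i) ∧ N j

    centre∉N : ∀ i → (x == i) ∧ N i ≡ false
    centre∉N i with x ≟ᶠ i
    ... | yes refl = x∉N
    ... | no _     = refl

    spoke⇒adj : ∀ i j → spoke i j ≡ true → adj G i j ≡ true
    spoke⇒adj i j sp with x ≟ᶠ i | N j in Nj
    spoke⇒adj i j refl | yes refl | true = N⊆adj j Nj

    spokes-disjoint : ∀ i j → spoke i j ∧ spoke j i ≡ false
    spokes-disjoint i j with x ≟ᶠ i
    ... | no _ = refl
    ... | yes refl rewrite x∉N | ∧-zeroʳ (x == j) = ∧-zeroʳ (N j)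

    star : Subgraph G
    star = record
      { vs     = λ i → (x == i) ∨ N i
      ; es     = λ i j → spoke i j ∨ spoke j i
      ; es-sym = λ i j → ∨-comm (spoke i j) (spoke j i)
      ; es-adj = es-adj′
      ; es-vs  = es-vs′
      }
      where
      es-adj′ : ∀ i j → spoke i j ∨ spoke j i ≡ true → adj G i j ≡ true
      es-adj′ i j e with spoke i j in sij
      ... | true  = spoke⇒adj i j sij
      ... | false = trans (adj-sym G i j) (spoke⇒adj j i e)
      es-vs′ : ∀ i j → spoke i j ∨ spoke j i ≡ true → (x == i) ∨ N i ≡ true
      es-vs′ i j e with x == i | x == j
      ... | true  | _    = refl
      ... | false | true = e

    vS-star : vS star ≡ suc (count N)
    vS-star = begin
      vS star                                  ≡⟨ count≡sum (vs star) ⟩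
      ∑[ i < n ] ⟦ (x == i) ∨ N i ⟧            ≡⟨ sum-cong-≗ (λ i → ⟦∨⟧-disjoint (x == i) (N i) (centre∉N i)) ⟩
      ∑[ i < n ] (⟦ x == i ⟧ + ⟦ N i ⟧)        ≡⟨ ∑-distrib-+ (λ i → ⟦ x == i ⟧) (λ i → ⟦ N i ⟧) ⟩
      ∑[ i < n ] ⟦ x == i ⟧ + ∑[ i < n ] ⟦ N i ⟧ ≡⟨ cong₂ _+_ (sum-== x) (sym (count≡sum N)) ⟩
      suc (count N)                            ∎
      where open ≡-Reasoning

    eS-star : eS star ≡ count N
    eS-star = *-cancelˡ-≡ (eS star) (count N) 2 (begin
      2 * eS star
        ≡⟨ double-eS star ⟨
      ∑[ i < n ] ∑[ j < n ] ⟦ spoke i j ∨ spoke j i ⟧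
        ≡⟨ sum-cong-≗ (λ i → sum-cong-≗ (λ j → ⟦∨⟧-disjoint (spoke i j) (spoke j i) (spokes-disjoint i j))) ⟩
      ∑[ i < n ] ∑[ j < n ] (⟦ spoke i j ⟧ + ⟦ spoke j i ⟧)
        ≡⟨ sum-cong-≗ (λ i → ∑-distrib-+ (λ j → ⟦ spoke i j ⟧) (λ j → ⟦ spoke j i ⟧)) ⟩
      ∑[ i < n ] (∑[ j < n ] ⟦ spoke i j ⟧ + ∑[ j < n ] ⟦ spoke j i ⟧)
        ≡⟨ ∑-distrib-+ (λ i → ∑[ j < n ] ⟦ spoke i j ⟧) (λ i → ∑[ j < n ] ⟦ spoke j i ⟧) ⟩
      S + ∑[ i < n ] ∑[ j < n ] ⟦ spoke j i ⟧
        ≡⟨ cong (S +_) (∑-comm (λ i j → ⟦ spoke j i ⟧)) ⟩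
      S + S
        ≡⟨ cong (λ t → t + t) S≡count ⟩
      count N + count N
        ≡⟨ cong (count N +_) (+-identityʳ (count N)) ⟨
      2 * count N ∎)
      where
      open ≡-Reasoning
      S : ℕ
      S = ∑[ i < n ] ∑[ j < n ] ⟦ spoke i j ⟧
      S≡count : S ≡ count N
      S≡count = begin
        S                                           ≡⟨ sum-cong-≗ (λ i → sum-cong-≗ (λ j → ⟦∧⟧ (x == i) (N j))) ⟩
        ∑[ i < n ] ∑[ j < n ] (⟦ x == i ⟧ * ⟦ N j ⟧) ≡⟨ sum-cong-≗ (λ i → *-distribˡ-sum ⟦ x == i ⟧ (λ j → ⟦ N j ⟧)) ⟨
        ∑[ i < n ] (⟦ x == i ⟧ * ∑[ j < n ] ⟦ N j ⟧) ≡⟨ sum-δ x (λ _ → ∑[ j < n ] ⟦ N j ⟧) ⟩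
        ∑[ j < n ] ⟦ N j ⟧                          ≡⟨ count≡sum N ⟨
        count N                                     ∎

  adj⇒≢ : ∀ {n} (G : Graph n) {x y} → adj G x y ≡ true → x ≢ y
  adj⇒≢ G {x} xy refl with trans (sym xy) (adj-irr G x)
  ... | ()

  m₂≥1-of-cherry : ∀ {n} {G : Graph n} {m x y z} → adj G x y ≡ true → adj G x z ≡ true → y ≢ z →
    IsM₂ G m → 1ℚ ℚ.≤ m
  m₂≥1-of-cherry {n} {G} {m} {x} {y} {z} xy xz y≢z (_ , ≤m) =
    subst₂ (λ v e → d₂ v e ℚ.≤ m) (trans vS-star (cong suc |N|≡2)) (trans eS-star |N|≡2) (≤m star)
    where
    N : Fin n → Bool
    N j = (y == j) ∨ (z == j)
    |N|≡2 : count N ≡ 2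
    |N|≡2 = count-pair y≢z
    N⊆adj : ∀ j → N j ≡ true → adj G x j ≡ true
    N⊆adj j Nj with y ≟ᶠ j | z ≟ᶠ j
    ... | yes refl | _        = xy
    ... | no _     | yes refl = xz
    x∉N : N x ≡ false
    x∉N = cong₂ _∨_ (==-false (adj⇒≢ G xy ∘ sym)) (==-false (adj⇒≢ G xz ∘ sym))
    open Star G x N N⊆adj x∉N

  m₂≥1-of-¬IsMatching : ∀ {n} {G : Graph n} {m} → ¬ IsMatching G → IsM₂ G m → 1ℚ ℚ.≤ m
  m₂≥1-of-¬IsMatching {G = G} ¬matching
    with _ , _ , _ , xy , xz , y≢z ← cherry-of-¬IsMatching G ¬matching = m₂≥1-of-cherry xy xz y≢z

  empty : ∀ {n} (G : Graph n) → Subgraph G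
  empty G = record
    { vs = λ _ → false ; es = λ _ _ → false ; es-sym = λ _ _ → refl ; es-adj = λ _ _ () ; es-vs = λ _ _ () }

  d₂′-edgeless : ∀ E mG v → d₂′ E mG v 0 ≡ 0ℚ
  d₂′-edgeless zero    _ _ = refl
  d₂′-edgeless (suc _) _ _ = refl

  m₂′-nonNeg : ∀ {nG nH} (G : Graph nG) (H : Graph nH) {mG m} → IsM₂′ G H mG m → 0ℚ ℚ.≤ m
  m₂′-nonNeg {nH = nH} G H {mG} {m} (_ , ≤m) =
    subst (ℚ._≤ m) (trans (cong (d₂′ (e G) mG (vS (empty H))) (countPairs-empty {nH} (λ _ _ → false) (λ _ _ → refl)))
                        (d₂′-edgeless (e G) mG (vS (empty H))))
          (≤m (empty H))

  full : ∀ {n} (G : Graph n) → Subgraph G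
  full G = record
    { vs = λ _ → true ; es = adj G ; es-sym = adj-sym G ; es-adj = λ _ _ ij → ij ; es-vs = λ _ _ _ → refl }

  2≤v-of-edge : ∀ {n} (G : Graph n) → 1 ≤ e G → 2 ≤ n
  2≤v-of-edge {n} G 1≤e = subst (2 ≤_) (trans (count≡sum {n} (λ _ → true)) (sum-ones n)) (2≤vS-of-edge (full G) 1≤e)

  restrict : ∀ {n} → (Fin n → Bool) → (Fin n → Fin n → Bool) → Fin n → Fin n → Bool
  restrict A r i j = A i ∧ (A j ∧ r i j)

  induced : ∀ {n} (G : Graph n) → (Fin n → Bool) → Subgraph G
  induced G A = record
    { vs     = A
    ; es     = restrict A (adj G)
    ; es-sym = λ i j → es-sym′ i j (A i) (A j)
    ; es-adj = λ i j → es-adj′ (A i) (A j)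
    ; es-vs  = λ i j → es-vs′ (A i)
    }
    where
    es-sym′ : ∀ i j a b → a ∧ (b ∧ adj G i j) ≡ b ∧ (a ∧ adj G j i)
    es-sym′ i j a b rewrite adj-sym G i j with a | b
    ... | true  | true  = refl
    ... | true  | false = refl
    ... | false | true  = refl
    ... | false | false = refl
    es-adj′ : ∀ a b {c} → a ∧ (b ∧ c) ≡ true → c ≡ true
    es-adj′ true true e = e
    es-vs′ : ∀ a {c} → a ∧ c ≡ true → a ≡ true
    es-vs′ true _ = refl

  -- addPair r u w i j unfolds to r i j ∨ newPair u w i j.
  newPair : ∀ {n} → Fin n → Fin n → Fin n → Fin n → Bool
  newPair u w i j = ((i == u) ∧ (j == w)) ∨ ((i == w) ∧ (j == u))

  newPair-true : ∀ {n} {u w i j : Fin n} → newPair u w i j ≡ true → (i ≡ u × j ≡ w) ⊎ (i ≡ w × j ≡ u)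
  newPair-true {u = u} {w} {i} {j} np with i ≟ᶠ u | j ≟ᶠ w | i ≟ᶠ w | j ≟ᶠ u
  ... | yes i≡u | yes j≡w | _       | _       = inj₁ (i≡u , j≡w)
  ... | yes _   | no _    | yes i≡w | yes j≡u = inj₂ (i≡w , j≡u)
  ... | no _    | _       | yes i≡w | yes j≡u = inj₂ (i≡w , j≡u)

  sum-newPair : ∀ {n} {u w : Fin n} → u ≢ w → ∑[ i < n ] ∑[ j < n ] ⟦ newPair u w i j ⟧ ≡ 2
  sum-newPair {n} {u} {w} u≢w = begin
    ∑[ i < n ] ∑[ j < n ] ⟦ newPair u w i j ⟧
      ≡⟨ sum-cong-≗ (λ i → sum-cong-≗ (λ j → split i j)) ⟩
    ∑[ i < n ] ∑[ j < n ] (⟦ i == u ⟧ * ⟦ j == w ⟧ + ⟦ i == w ⟧ * ⟦ j == u ⟧)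
      ≡⟨ sum-cong-≗ (λ i → ∑-distrib-+ (λ j → ⟦ i == u ⟧ * ⟦ j == w ⟧) (λ j → ⟦ i == w ⟧ * ⟦ j == u ⟧)) ⟩
    ∑[ i < n ] (∑[ j < n ] (⟦ i == u ⟧ * ⟦ j == w ⟧) + ∑[ j < n ] (⟦ i == w ⟧ * ⟦ j == u ⟧))
      ≡⟨ ∑-distrib-+ (λ i → ∑[ j < n ] (⟦ i == u ⟧ * ⟦ j == w ⟧)) (λ i → ∑[ j < n ] (⟦ i == w ⟧ * ⟦ j == u ⟧)) ⟩
    ∑[ i < n ] ∑[ j < n ] (⟦ i == u ⟧ * ⟦ j == w ⟧) + ∑[ i < n ] ∑[ j < n ] (⟦ i == w ⟧ * ⟦ j == u ⟧)
      ≡⟨ cong₂ _+_ (point u w) (point w u) ⟩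
    2 ∎
    where
    open ≡-Reasoning
    split : ∀ i j → ⟦ newPair u w i j ⟧ ≡ ⟦ i == u ⟧ * ⟦ j == w ⟧ + ⟦ i == w ⟧ * ⟦ j == u ⟧
    split i j = trans (⟦∨⟧-disjoint ((i == u) ∧ (j == w)) ((i == w) ∧ (j == u)) (disjoint (i == u) (i == w) i≢u∨i≢w))
                      (cong₂ _+_ (⟦∧⟧ (i == u) (j == w)) (⟦∧⟧ (i == w) (j == u)))
      where
      i≢u∨i≢w : (i == u) ∧ (i == w) ≡ false
      i≢u∨i≢w with i ≟ᶠ u | i ≟ᶠ w
      ... | yes refl | yes refl = ⊥-elim (u≢w refl)
      ... | yes _    | no _     = refl
      ... | no _     | _        = refl
      disjoint : ∀ a b {c d} → a ∧ b ≡ false → (a ∧ c) ∧ (b ∧ d) ≡ false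
      disjoint true  true  ()
      disjoint true  false {c} _ = ∧-zeroʳ c
      disjoint false b         _ = refl
    point : ∀ a b → ∑[ i < n ] ∑[ j < n ] (⟦ i == a ⟧ * ⟦ j == b ⟧) ≡ 1
    point a b = begin
      ∑[ i < n ] ∑[ j < n ] (⟦ i == a ⟧ * ⟦ j == b ⟧)
        ≡⟨ sum-cong-≗ (λ i → *-distribˡ-sum ⟦ i == a ⟧ (λ j → ⟦ j == b ⟧)) ⟨
      ∑[ i < n ] (⟦ i == a ⟧ * ∑[ j < n ] ⟦ j == b ⟧)
        ≡⟨ sum-cong-≗ (λ i → cong (⟦ i == a ⟧ *_) (sum-==ʳ b)) ⟩
      ∑[ i < n ] (⟦ i == a ⟧ * 1)
        ≡⟨ sum-cong-≗ (λ i → *-identityʳ ⟦ i == a ⟧) ⟩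
      ∑[ i < n ] ⟦ i == a ⟧
        ≡⟨ sum-==ʳ a ⟩
      1 ∎

  restrict-sym : ∀ {n} (A : Fin n → Bool) {r} → Symmetric r → Symmetric (restrict A r)
  restrict-sym A {r} r-sym i j rewrite r-sym i j with A i | A j
  ... | true  | true  = refl
  ... | true  | false = refl
  ... | false | true  = refl
  ... | false | false = refl

  restrict-irrefl : ∀ {n} (A : Fin n → Bool) {r} → Irreflexive r → Irreflexive (restrict A r)
  restrict-irrefl A r-irr i rewrite r-irr i = trans (cong (A i ∧_) (∧-zeroʳ (A i))) (∧-zeroʳ (A i))

  ⟦⟧+⟦not⟧ : ∀ b → 1 ≡ ⟦ b ⟧ + ⟦ not b ⟧ * 1
  ⟦⟧+⟦not⟧ true  = refl
  ⟦⟧+⟦not⟧ false = refl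

  module _ {n} (A : Fin n → Bool) (r : Fin n → Fin n → Bool) (r-sym : Symmetric r) (r-irr : Irreflexive r)
           {u w : Fin n} (u≢w : u ≢ w) (Au : A u ≡ true) (Aw : A w ≡ true) where

    ⟦restrict-addPair⟧ : ∀ i j →
      ⟦ restrict A (addPair r u w) i j ⟧ ≡ ⟦ restrict A r i j ⟧ + ⟦ not (r u w) ⟧ * ⟦ newPair u w i j ⟧
    ⟦restrict-addPair⟧ i j with newPair u w i j in np
    ... | false rewrite ∨-identityʳ (r i j) | *-zeroʳ ⟦ not (r u w) ⟧ = sym (+-identityʳ _)
    ... | true with newPair-true {u = u} {w} {i} {j} np
    ...   | inj₁ (refl , refl) rewrite Au | Aw | ∨-zeroʳ (r u w)             = ⟦⟧+⟦not⟧ (r u w)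
    ...   | inj₂ (refl , refl) rewrite Au | Aw | ∨-zeroʳ (r w u) | r-sym w u = ⟦⟧+⟦not⟧ (r u w)

    double-restrict-addPair : ∑[ i < n ] ∑[ j < n ] ⟦ restrict A (addPair r u w) i j ⟧ ≡
                              2 * countPairs (restrict A r) + ⟦ not (r u w) ⟧ * 2
    double-restrict-addPair = begin
      ∑[ i < n ] ∑[ j < n ] ⟦ restrict A (addPair r u w) i j ⟧
        ≡⟨ sum-cong-≗ (λ i → sum-cong-≗ (⟦restrict-addPair⟧ i)) ⟩
      ∑[ i < n ] ∑[ j < n ] (⟦ restrict A r i j ⟧ + b * ⟦ newPair u w i j ⟧)
        ≡⟨ sum-cong-≗ (λ i → ∑-distrib-+ (λ j → ⟦ restrict A r i j ⟧) (λ j → b * ⟦ newPair u w i j ⟧)) ⟩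
      ∑[ i < n ] (∑[ j < n ] ⟦ restrict A r i j ⟧ + ∑[ j < n ] (b * ⟦ newPair u w i j ⟧))
        ≡⟨ ∑-distrib-+ (λ i → ∑[ j < n ] ⟦ restrict A r i j ⟧) (λ i → ∑[ j < n ] (b * ⟦ newPair u w i j ⟧)) ⟩
      ∑[ i < n ] ∑[ j < n ] ⟦ restrict A r i j ⟧ + ∑[ i < n ] ∑[ j < n ] (b * ⟦ newPair u w i j ⟧)
        ≡⟨ cong₂ _+_ (double-countPairs (restrict A r) (restrict-sym A {r} r-sym) (restrict-irrefl A {r} r-irr))
                     pull-b ⟩
      2 * countPairs (restrict A r) + b * 2 ∎
      where
      open ≡-Reasoning
      b : ℕ
      b = ⟦ not (r u w) ⟧
      pull-b : ∑[ i < n ] ∑[ j < n ] (b * ⟦ newPair u w i j ⟧) ≡ b * 2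
      pull-b = begin
        ∑[ i < n ] ∑[ j < n ] (b * ⟦ newPair u w i j ⟧)
          ≡⟨ sum-cong-≗ (λ i → *-distribˡ-sum b (λ j → ⟦ newPair u w i j ⟧)) ⟨
        ∑[ i < n ] (b * ∑[ j < n ] ⟦ newPair u w i j ⟧)
          ≡⟨ *-distribˡ-sum b (λ i → ∑[ j < n ] ⟦ newPair u w i j ⟧) ⟨
        b * ∑[ i < n ] ∑[ j < n ] ⟦ newPair u w i j ⟧
          ≡⟨ cong (b *_) (sum-newPair u≢w) ⟩
        b * 2 ∎

module Completion {n} (G G₋ : Graph n) {u w : Fin n} (u≢w : u ≢ w) (σ : Permutation′ n)
  (iso : ∀ i j → adj G i j ≡ addPair (adj G₋) u w (σ ⟨$⟩ʳ i) (σ ⟨$⟩ʳ j)) where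

  open FiniteSums
  open RationalBounds using (d₂-reciprocal-bound; reciprocal-of-≥1)
  open Subgraphs
  open import Data.Nat using (ℕ; suc; _+_; _*_; _∸_; _≤_; s≤s)
  open import Data.Nat.Properties
  import Data.Rational as ℚ
  import Data.Rational.Properties as ℚ
  open import Data.Rational using (1ℚ)

  double-restrict-G : ∀ A → A u ≡ true → A w ≡ true →
    ∑[ i < n ] ∑[ j < n ] ⟦ restrict (A ∘ (σ ⟨$⟩ʳ_)) (adj G) i j ⟧ ≡
    2 * countPairs (restrict A (adj G₋)) + ⟦ not (adj G₋ u w) ⟧ * 2
  double-restrict-G A Au Aw = begin
    ∑[ i < n ] ∑[ j < n ] ⟦ restrict (A ∘ (σ ⟨$⟩ʳ_)) (adj G) i j ⟧
      ≡⟨ sum-cong-≗ (λ i → sum-cong-≗ (λ j → cong (λ b → ⟦ A (σ ⟨$⟩ʳ i) ∧ (A (σ ⟨$⟩ʳ j) ∧ b) ⟧) (iso i j))) ⟩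
    ∑[ i < n ] ∑[ j < n ] ⟦ restrict A (addPair (adj G₋) u w) (σ ⟨$⟩ʳ i) (σ ⟨$⟩ʳ j) ⟧
      ≡⟨ sum²-permute σ (λ p q → ⟦ restrict A (addPair (adj G₋) u w) p q ⟧) ⟩
    ∑[ p < n ] ∑[ q < n ] ⟦ restrict A (addPair (adj G₋) u w) p q ⟧
      ≡⟨ double-restrict-addPair A (adj G₋) (adj-sym G₋) (adj-irr G₋) u≢w Au Aw ⟩
    2 * countPairs (restrict A (adj G₋)) + ⟦ not (adj G₋ u w) ⟧ * 2 ∎
    where open ≡-Reasoning

  uw∉G₋ : suc (e G₋) ≡ e G → adj G₋ u w ≡ false
  uw∉G₋ e₋+1≡e with adj G₋ u w in uw
  ... | false = refl
  ... | true  = ⊥-elim (1+n≢n (trans e₋+1≡e (*-cancelˡ-≡ (e G) (e G₋) 2 (begin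
    2 * e G                             ≡⟨ double-countPairs (adj G) (adj-sym G) (adj-irr G) ⟨
    ∑[ i < n ] ∑[ j < n ] ⟦ adj G i j ⟧ ≡⟨ double-restrict-G (λ _ → true) refl refl ⟩
    2 * e G₋ + ⟦ not (adj G₋ u w) ⟧ * 2 ≡⟨ cong (λ b → 2 * e G₋ + ⟦ not b ⟧ * 2) uw ⟩
    2 * e G₋ + 0                        ≡⟨ +-identityʳ (2 * e G₋) ⟩
    2 * e G₋                            ∎))))
    where open ≡-Reasoning

  module Spanned (A : Fin n → Bool) (Au : A u ≡ true) (Aw : A w ≡ true) (uw∉G₋ : adj G₋ u w ≡ false) where

    ε : ℕ
    ε = countPairs (restrict A (adj G₋))

    -- The copy of G₋[A] + uw inside G, transported along σ.
    spanned : Subgraph G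
    spanned = induced G (A ∘ (σ ⟨$⟩ʳ_))

    vS-spanned : vS spanned ≡ count A
    vS-spanned = begin
      vS spanned                 ≡⟨ count≡sum (A ∘ (σ ⟨$⟩ʳ_)) ⟩
      ∑[ i < n ] ⟦ A (σ ⟨$⟩ʳ i) ⟧ ≡⟨ ∑-permute (λ p → ⟦ A p ⟧) σ ⟨
      ∑[ p < n ] ⟦ A p ⟧         ≡⟨ count≡sum A ⟨
      count A                    ∎
      where open ≡-Reasoning

    eS-spanned : eS spanned ≡ suc ε
    eS-spanned = *-cancelˡ-≡ (eS spanned) (suc ε) 2 (begin
      2 * eS spanned                                          ≡⟨ double-eS spanned ⟨
      ∑[ i < n ] ∑[ j < n ] ⟦ es spanned i j ⟧                ≡⟨ double-restrict-G A Au Aw ⟩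
      2 * ε + ⟦ not (adj G₋ u w) ⟧ * 2                        ≡⟨ cong (λ b → 2 * ε + ⟦ not b ⟧ * 2) uw∉G₋ ⟩
      2 * ε + 2                                               ≡⟨ +-comm (2 * ε) 2 ⟩
      2 + 2 * ε                                               ≡⟨ *-suc 2 ε ⟨
      2 * suc ε                                               ∎)
      where open ≡-Reasoning

    ε≡0-of-count≡2 : count A ≡ 2 → ε ≡ 0
    ε≡0-of-count≡2 |A|≡2 = countPairs-empty (restrict A (adj G₋)) no-pair
      where
      A⊆uw : ∀ p → A p ≡ true → p ≡ u ⊎ p ≡ w
      A⊆uw p Ap with p ≟ᶠ u | p ≟ᶠ w
      ... | yes p≡u | _       = inj₁ p≡u
      ... | no _    | yes p≡w = inj₂ p≡w
      ... | no p≢u  | no p≢w  with s≤s (s≤s ()) ← subst (3 ≤_) |A|≡2 (3≤count A u≢w p≢u p≢w Au Aw Ap)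
      no-pair : ∀ p q → restrict A (adj G₋) p q ≡ false
      no-pair p q with A p in Ap | A q in Aq
      ... | false | _     = refl
      ... | true  | false = refl
      ... | true  | true  with A⊆uw p Ap | A⊆uw q Aq
      ...   | inj₁ refl | inj₁ refl = adj-irr G₋ u
      ...   | inj₁ refl | inj₂ refl = uw∉G₋
      ...   | inj₂ refl | inj₁ refl = trans (adj-sym G₋ w u) uw∉G₋
      ...   | inj₂ refl | inj₂ refl = adj-irr G₋ w

    density-bound : ∀ {mG} → IsM₂ G mG → 1ℚ ℚ.≤ mG → 2 ≤ count A →
      (1ℚ ÷₀ mG) ℚ.* ℕ→ℚ ε ℚ.≤ ℕ→ℚ (count A ∸ 2)
    density-bound {mG} (_ , ≤mG) 1≤mG with 0<c , _ , c*mG≡1 ← reciprocal-of-≥1 1≤mG = bound (count A) refl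
      where
      c : ℚ.ℚ
      c = 1ℚ ÷₀ mG
      bound : ∀ a → count A ≡ a → 2 ≤ a → c ℚ.* ℕ→ℚ ε ℚ.≤ ℕ→ℚ (a ∸ 2)
      bound 1 _ (s≤s ())
      bound 2 |A|≡2 _ rewrite ε≡0-of-count≡2 |A|≡2 = ℚ.≤-reflexive (ℚ.*-zeroʳ c)
      bound (suc (suc (suc k))) |A|≡a _ = d₂-reciprocal-bound k ε (ℚ.<⇒≤ 0<c) c*mG≡1
        (subst₂ (λ v e → d₂ v e ℚ.≤ mG) (trans vS-spanned |A|≡a) eS-spanned (≤mG spanned))

module CentralCopyCounting {n h N} (H : Graph h) (G₋ : Graph n) (K : Graph N) (φ : Fin n → Fin N)
  (cc : CentralCopy G₋ H K φ) (J : Subgraph K) where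

  open FiniteSums
  open RationalBounds using (affine-nonNeg; copy-edge-bound; reciprocal-of-≥1; ℕ→ℚ-mono-≤; ℕ→ℚ-sum-≤)
  open Subgraphs using (restrict; m₂′-nonNeg; double-eS; 2≤vS-of-edge)
  open import Data.Nat using (ℕ; suc; _+_; _*_; _∸_; _≤_; _<?_; z≤n; s≤s)
  open import Data.Nat.Properties
  open import Algebra.Properties.CommutativeSemigroup *-commutativeSemigroup using (x∙yz≈y∙xz)
  import Data.Rational as ℚ
  import Data.Rational.Properties as ℚ
  open import Data.Rational using (1ℚ)
  open CentralCopy cc

  -- ψ i j is a copy of H only when i < j and ij is an edge of G₋; the factor ed i j discards the
  -- junk values of ψ at all other pairs.
  ed : Fin n → Fin n → ℕ
  ed i j = ⟦ lt i j ∧ adj G₋ i j ⟧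

  ed-of-edge : ∀ {i j} → IsEdge< G₋ i j → ed i j ≡ 1
  ed-of-edge {i} {j} (i<j , ij∈G₋) rewrite dec-true (toℕ i <? toℕ j) i<j | ij∈G₋ = refl

  edge-or-ed≡0 : ∀ i j → IsEdge< G₋ i j ⊎ ed i j ≡ 0
  edge-or-ed≡0 i j with adj G₋ i j | toℕ i <? toℕ j
  ... | true  | yes i<j = inj₁ (i<j , refl)
  ... | true  | no i≮j  = inj₂ (cong ⟦_⟧ (trans (∧-identityʳ (lt i j)) (dec-false (toℕ i <? toℕ j) i≮j)))
  ... | false | _       = inj₂ (cong ⟦_⟧ (∧-zeroʳ (lt i j)))

  isNew : Fin n → Fin n → Fin h → Bool
  isNew i j a = not (ψ i j a == φ i) ∧ not (ψ i j a == φ j)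

  J-in-copy : Fin n → Fin n → Subgraph H
  J-in-copy i j = record
    { vs     = λ a → vs J (ψ i j a)
    ; es     = λ a b → adj H a b ∧ es J (ψ i j a) (ψ i j b)
    ; es-sym = λ a b → cong₂ _∧_ (adj-sym H a b) (es-sym J _ _)
    ; es-adj = λ a b → ∧-trueˡ
    ; es-vs  = λ a b ab → es-vs J _ _ (∧-trueʳ {adj H a b} ab)
    }
    where
    ∧-trueˡ : ∀ {a b} → a ∧ b ≡ true → a ≡ true
    ∧-trueˡ {true} _ = refl
    ∧-trueʳ : ∀ {a b} → a ∧ b ≡ true → b ≡ true
    ∧-trueʳ {true} ab = ab

  newInJ new : Fin n → Fin n → ℕ
  newInJ i j = ∑[ a < h ] (⟦ vs J (ψ i j a) ⟧ * ⟦ isNew i j a ⟧)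
  new    i j = ∑[ a < h ] ⟦ isNew i j a ⟧

  newVerticesInJ : ℕ
  newVerticesInJ = ∑[ i < n ] ∑[ j < n ] (ed i j * newInJ i j)

  φi≢φj : ∀ {i j} → IsEdge< G₋ i j → φ i ≢ φ j
  φi≢φj (i<j , _) φi≡φj = <-irrefl (cong toℕ (φ-inj φi≡φj)) i<j

  eS-J≤ : eS J ≤ ∑[ i < n ] ∑[ j < n ] (ed i j * eS (J-in-copy i j))
  eS-J≤ = *-cancelˡ-≤ 2 (begin
    2 * eS J                                            ≡⟨ double-eS J ⟨
    ∑[ x < N ] ∑[ y < N ] ⟦ es J x y ⟧                  ≤⟨ sum-mono (λ x → sum-mono (λ y → covered x y)) ⟩
    ∑[ x < N ] ∑[ y < N ] ∑[ i < n ] ∑[ j < n ] (ed i j * W i j x y)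
                                                        ≡⟨ sum²-comm (λ x y i j → ed i j * W i j x y) ⟩
    ∑[ i < n ] ∑[ j < n ] ∑[ x < N ] ∑[ y < N ] (ed i j * W i j x y)
                                                        ≡⟨ sum-cong-≗ (λ i → sum-cong-≗ (λ j → per-copy i j)) ⟩
    ∑[ i < n ] ∑[ j < n ] (2 * (ed i j * eS (J-in-copy i j)))
                                                        ≡⟨ *-distribˡ-sum² 2 (λ i j → ed i j * eS (J-in-copy i j)) ⟨
    2 * ∑[ i < n ] ∑[ j < n ] (ed i j * eS (J-in-copy i j)) ∎)
    where
    open ≤-Reasoning
    T : Fin n → Fin n → Fin h → Fin h → ℕ
    T i j a b = ⟦ es (J-in-copy i j) a b ⟧
    W : Fin n → Fin n → Fin N → Fin N → ℕ
    W i j x y = fibreSum (ψ i j) (λ a → fibreSum (ψ i j) (T i j a) y) x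
    covered : ∀ x y → ⟦ es J x y ⟧ ≤ ∑[ i < n ] ∑[ j < n ] (ed i j * W i j x y)
    covered x y with es J x y in xy
    ... | false = z≤n
    ... | true with edges-covered x y (es-adj J x y xy)
    ...   | i , j , a , b , ij∈G₋ , ab∈H , refl , refl = ≤-trans 1≤edW (sum²-term (λ i j → ed i j * W i j x y) i j)
      where
      1≤T : 1 ≤ T i j a b
      1≤T rewrite ab∈H | xy = ≤-refl
      1≤edW : 1 ≤ ed i j * W i j x y
      1≤edW rewrite ed-of-edge ij∈G₋ | +-identityʳ (W i j x y) =
        fibreSum-hit (ψ i j) _ a (fibreSum-hit (ψ i j) (T i j a) b 1≤T)
    per-copy : ∀ i j → ∑[ x < N ] ∑[ y < N ] (ed i j * W i j x y) ≡ 2 * (ed i j * eS (J-in-copy i j))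
    per-copy i j = begin-equality
      ∑[ x < N ] ∑[ y < N ] (ed i j * W i j x y)   ≡⟨ *-distribˡ-sum² (ed i j) (W i j) ⟨
      ed i j * ∑[ x < N ] ∑[ y < N ] W i j x y     ≡⟨ cong (ed i j *_) (sum-fibres² (ψ i j) (T i j)) ⟩
      ed i j * ∑[ a < h ] ∑[ b < h ] T i j a b     ≡⟨ cong (ed i j *_) (double-eS (J-in-copy i j)) ⟩
      ed i j * (2 * eS (J-in-copy i j))            ≡⟨ x∙yz≈y∙xz (ed i j) 2 (eS (J-in-copy i j)) ⟩
      2 * (ed i j * eS (J-in-copy i j))            ∎

  sum-central-pairs : ∑[ i < n ] ∑[ j < n ] (ed i j * ⟦ vs J (φ i) ∧ vs J (φ j) ⟧) ≡
                      countPairs (restrict (vs J ∘ φ) (adj G₋))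
  sum-central-pairs =
    trans (sum-cong-≗ (λ i → sum-cong-≗ (λ j → ⟦∧⟧*⟦∧⟧ (lt i j) (adj G₋ i j) (vs J (φ i)) (vs J (φ j)))))
                            (sym (countPairs≡sum (restrict (vs J ∘ φ) (adj G₋))))

  vS-J-in-copy≤ : ∀ {i j} → IsEdge< G₋ i j → vS (J-in-copy i j) ≤ newInJ i j + (⟦ vs J (φ i) ⟧ + ⟦ vs J (φ j) ⟧)
  vS-J-in-copy≤ {i} {j} ij∈G₋ with a₀ , b₀ , _ , ψa₀≡φi , ψb₀≡φj ← ψ-contains i j ij∈G₋ = begin
    vS (J-in-copy i j)
      ≡⟨ count≡sum (vs J ∘ ψ i j) ⟩
    ∑[ a < h ] inJ a
      ≤⟨ sum-mono (λ a → split (vs J (ψ i j a)) (ψ i j a == φ i) (ψ i j a == φ j)) ⟩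
    ∑[ a < h ] (inJ a * ⟦ isNew i j a ⟧ + (⟦ ψ i j a == φ i ⟧ * inJ a + ⟦ ψ i j a == φ j ⟧ * inJ a))
      ≡⟨ ∑-distrib-+ (λ a → inJ a * ⟦ isNew i j a ⟧) _ ⟩
    newInJ i j + ∑[ a < h ] (⟦ ψ i j a == φ i ⟧ * inJ a + ⟦ ψ i j a == φ j ⟧ * inJ a)
      ≡⟨ cong (newInJ i j +_) (∑-distrib-+ (λ a → ⟦ ψ i j a == φ i ⟧ * inJ a) _) ⟩
    newInJ i j + (fibreSum (ψ i j) inJ (φ i) + fibreSum (ψ i j) inJ (φ j))
      ≡⟨ cong (newInJ i j +_) (cong₂ _+_ (central ψa₀≡φi) (central ψb₀≡φj)) ⟩
    newInJ i j + (⟦ vs J (φ i) ⟧ + ⟦ vs J (φ j) ⟧) ∎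
    where
    open ≤-Reasoning
    inJ : Fin h → ℕ
    inJ a = ⟦ vs J (ψ i j a) ⟧
    central : ∀ {a₀ x} → ψ i j a₀ ≡ x → fibreSum (ψ i j) inJ x ≡ ⟦ vs J x ⟧
    central ψa₀≡x = trans (fibreSum-injective (ψ-inj i j ij∈G₋) inJ ψa₀≡x) (cong (⟦_⟧ ∘ vs J) ψa₀≡x)
    split : ∀ b s t → ⟦ b ⟧ ≤ ⟦ b ⟧ * ⟦ not s ∧ not t ⟧ + (⟦ s ⟧ * ⟦ b ⟧ + ⟦ t ⟧ * ⟦ b ⟧)
    split false _     _     = z≤n
    split true  true  _     = s≤s z≤n
    split true  false true  = s≤s z≤n
    split true  false false = s≤s z≤n

  new+2≡h : ∀ {i j} → IsEdge< G₋ i j → new i j + 2 ≡ h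
  new+2≡h {i} {j} ij∈G₋ with a₀ , b₀ , _ , ψa₀≡φi , ψb₀≡φj ← ψ-contains i j ij∈G₋ = begin
    new i j + (1 + 1)
      ≡⟨ cong (λ t → new i j + t) (cong₂ _+_ (hits ψa₀≡φi) (hits ψb₀≡φj)) ⟨
    new i j + (∑[ a < h ] ⟦ ψ i j a == φ i ⟧ + ∑[ a < h ] ⟦ ψ i j a == φ j ⟧)
      ≡⟨ cong (new i j +_) (∑-distrib-+ (λ a → ⟦ ψ i j a == φ i ⟧) (λ a → ⟦ ψ i j a == φ j ⟧)) ⟨
    new i j + ∑[ a < h ] (⟦ ψ i j a == φ i ⟧ + ⟦ ψ i j a == φ j ⟧)
      ≡⟨ ∑-distrib-+ (⟦_⟧ ∘ isNew i j) (λ a → ⟦ ψ i j a == φ i ⟧ + ⟦ ψ i j a == φ j ⟧) ⟨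
    ∑[ a < h ] (⟦ isNew i j a ⟧ + (⟦ ψ i j a == φ i ⟧ + ⟦ ψ i j a == φ j ⟧))
      ≡⟨ sum-cong-≗ (λ a → trichotomy (ψ i j a)) ⟩
    ∑[ a < h ] 1
      ≡⟨ sum-ones h ⟩
    h ∎
    where
    open ≡-Reasoning
    hits : ∀ {a₀ x} → ψ i j a₀ ≡ x → ∑[ a < h ] ⟦ ψ i j a == x ⟧ ≡ 1
    hits {x = x} ψa₀≡x = trans (sum-cong-≗ (λ a → sym (*-identityʳ ⟦ ψ i j a == x ⟧)))
                               (fibreSum-injective (ψ-inj i j ij∈G₋) (λ _ → 1) ψa₀≡x)
    trichotomy : ∀ z → ⟦ not (z == φ i) ∧ not (z == φ j) ⟧ + (⟦ z == φ i ⟧ + ⟦ z == φ j ⟧) ≡ 1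
    trichotomy z with z ≟ᶠ φ i | z ≟ᶠ φ j
    ... | yes refl | yes z≡φj = ⊥-elim (φi≢φj ij∈G₋ z≡φj)
    ... | yes _    | no _     = refl
    ... | no _     | yes _    = refl
    ... | no _     | no _     = refl

  sum-new : ∑[ i < n ] ∑[ j < n ] (ed i j * new i j) ≡ e G₋ * (h ∸ 2)
  sum-new = begin
    ∑[ i < n ] ∑[ j < n ] (ed i j * new i j)     ≡⟨ sum-cong-≗ (λ i → sum-cong-≗ (λ j → per-pair i j)) ⟩
    ∑[ i < n ] ∑[ j < n ] ((h ∸ 2) * ed i j)     ≡⟨ *-distribˡ-sum² (h ∸ 2) ed ⟨
    (h ∸ 2) * ∑[ i < n ] ∑[ j < n ] ed i j       ≡⟨ cong ((h ∸ 2) *_) (countPairs≡sum (adj G₋)) ⟨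
    (h ∸ 2) * e G₋                               ≡⟨ *-comm (h ∸ 2) (e G₋) ⟩
    e G₋ * (h ∸ 2)                               ∎
    where
    open ≡-Reasoning
    per-pair : ∀ i j → ed i j * new i j ≡ (h ∸ 2) * ed i j
    per-pair i j with edge-or-ed≡0 i j
    ... | inj₂ ed≡0 rewrite ed≡0 = sym (*-zeroʳ (h ∸ 2))
    ... | inj₁ ij∈G₋ rewrite ed-of-edge ij∈G₋ =
      trans (+-identityʳ (new i j)) (trans (sym (m+n∸n≡m (new i j) 2))
        (trans (cong (_∸ 2) (new+2≡h ij∈G₋)) (sym (*-identityʳ (h ∸ 2)))))

  mult : Fin N → ℕ
  mult x = fibreSum φ (λ _ → 1) x + ∑[ i < n ] ∑[ j < n ] (ed i j * fibreSum (ψ i j) (⟦_⟧ ∘ isNew i j) x)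

  sum-weighted-mult : ∀ (w : Fin N → ℕ) → ∑[ x < N ] (w x * mult x) ≡
    ∑[ u < n ] w (φ u) + ∑[ i < n ] ∑[ j < n ] (ed i j * ∑[ a < h ] (w (ψ i j a) * ⟦ isNew i j a ⟧))
  sum-weighted-mult w = begin
    ∑[ x < N ] (w x * mult x)
      ≡⟨ sum-cong-≗ (λ x → *-distribˡ-+ (w x) (C x) (F x)) ⟩
    ∑[ x < N ] (w x * C x + w x * F x)
      ≡⟨ ∑-distrib-+ (λ x → w x * C x) (λ x → w x * F x) ⟩
    ∑[ x < N ] (w x * C x) + ∑[ x < N ] (w x * F x)
      ≡⟨ cong₂ _+_ central copies ⟩
    ∑[ u < n ] w (φ u) + ∑[ i < n ] ∑[ j < n ] (ed i j * ∑[ a < h ] (w (ψ i j a) * ⟦ isNew i j a ⟧)) ∎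
    where
    open ≡-Reasoning
    C F : Fin N → ℕ
    C = fibreSum φ (λ _ → 1)
    F x = ∑[ i < n ] ∑[ j < n ] (ed i j * fibreSum (ψ i j) (⟦_⟧ ∘ isNew i j) x)
    central : ∑[ x < N ] (w x * C x) ≡ ∑[ u < n ] w (φ u)
    central = trans (sum-weighted-fibres φ w (λ _ → 1)) (sum-cong-≗ (λ u → *-identityʳ (w (φ u))))
    copies : ∑[ x < N ] (w x * F x) ≡ ∑[ i < n ] ∑[ j < n ] (ed i j * ∑[ a < h ] (w (ψ i j a) * ⟦ isNew i j a ⟧))
    copies = begin
      ∑[ x < N ] (w x * F x)
        ≡⟨ sum-cong-≗ (λ x → *-distribˡ-sum² (w x) (λ i j → ed i j * fibreSum (ψ i j) (⟦_⟧ ∘ isNew i j) x)) ⟩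
      ∑[ x < N ] ∑[ i < n ] ∑[ j < n ] (w x * (ed i j * fibreSum (ψ i j) (⟦_⟧ ∘ isNew i j) x))
        ≡⟨ sum-cong-≗ (λ x → sum-cong-≗ (λ i → sum-cong-≗ (λ j → x∙yz≈y∙xz (w x) (ed i j) _))) ⟩
      ∑[ x < N ] ∑[ i < n ] ∑[ j < n ] (ed i j * (w x * fibreSum (ψ i j) (⟦_⟧ ∘ isNew i j) x))
        ≡⟨ sum-sum²-comm (λ x i j → ed i j * (w x * fibreSum (ψ i j) (⟦_⟧ ∘ isNew i j) x)) ⟩
      ∑[ i < n ] ∑[ j < n ] ∑[ x < N ] (ed i j * (w x * fibreSum (ψ i j) (⟦_⟧ ∘ isNew i j) x))
        ≡⟨ sum-cong-≗ (λ i → sum-cong-≗ (λ j →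
             *-distribˡ-sum (ed i j) (λ x → w x * fibreSum (ψ i j) (⟦_⟧ ∘ isNew i j) x))) ⟨
      ∑[ i < n ] ∑[ j < n ] (ed i j * ∑[ x < N ] (w x * fibreSum (ψ i j) (⟦_⟧ ∘ isNew i j) x))
        ≡⟨ sum-cong-≗ (λ i → sum-cong-≗ (λ j → cong (ed i j *_) (sum-weighted-fibres (ψ i j) w (⟦_⟧ ∘ isNew i j)))) ⟩
      ∑[ i < n ] ∑[ j < n ] (ed i j * ∑[ a < h ] (w (ψ i j a) * ⟦ isNew i j a ⟧)) ∎

  central-hit : ∀ u → 1 ≤ mult (φ u)
  central-hit u = ≤-trans (fibreSum-hit φ (λ _ → 1) u ≤-refl) (m≤m+n _ _)

  mult-positive : ∀ x → 1 ≤ mult x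
  mult-positive x with vertices-covered x
  ... | inj₁ (u , refl) = central-hit u
  ... | inj₂ (i , j , a , ij∈G₋ , refl) with ψ i j a ≟ᶠ φ i | ψ i j a ≟ᶠ φ j
  ...   | yes ψa≡φi | _         = subst (λ y → 1 ≤ mult y) (sym ψa≡φi) (central-hit i)
  ...   | no _      | yes ψa≡φj = subst (λ y → 1 ≤ mult y) (sym ψa≡φj) (central-hit j)
  ...   | no ψa≢φi  | no ψa≢φj  = ≤-trans copy-hit (≤-trans (sum²-term F i j) (m≤n+m _ _))
    where
    F : Fin n → Fin n → ℕ
    F k l = ed k l * fibreSum (ψ k l) (⟦_⟧ ∘ isNew k l) (ψ i j a)
    isNew-a : 1 ≤ ⟦ isNew i j a ⟧
    isNew-a rewrite ==-false ψa≢φi | ==-false ψa≢φj = ≤-refl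
    copy-hit : 1 ≤ F i j
    copy-hit rewrite ed-of-edge ij∈G₋ = ≤-trans (fibreSum-hit (ψ i j) _ a isNew-a) (m≤m+n _ 0)

  vertex-count : N + (count (vs J ∘ φ) + newVerticesInJ) ≤ vS J + (n + e G₋ * (h ∸ 2))
  vertex-count = begin
    N + (count (vs J ∘ φ) + newVerticesInJ)
      ≡⟨ cong₂ _+_ (sym (sum-ones N))
           (trans (cong (_+ newVerticesInJ) (count≡sum (vs J ∘ φ))) (sym (sum-weighted-mult (⟦_⟧ ∘ vs J)))) ⟩
    ∑[ x < N ] 1 + ∑[ x < N ] (⟦ vs J x ⟧ * mult x)
      ≡⟨ ∑-distrib-+ (λ _ → 1) (λ x → ⟦ vs J x ⟧ * mult x) ⟨
    ∑[ x < N ] (1 + ⟦ vs J x ⟧ * mult x)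
      ≤⟨ sum-mono (λ x → absorb (vs J x) (mult-positive x)) ⟩
    ∑[ x < N ] (⟦ vs J x ⟧ + mult x)
      ≡⟨ ∑-distrib-+ (⟦_⟧ ∘ vs J) mult ⟩
    ∑[ x < N ] ⟦ vs J x ⟧ + ∑[ x < N ] mult x
      ≡⟨ cong₂ _+_ (count≡sum (vs J)) total ⟨
    vS J + (n + e G₋ * (h ∸ 2)) ∎
    where
    open ≤-Reasoning
    absorb : ∀ b {m} → 1 ≤ m → 1 + ⟦ b ⟧ * m ≤ ⟦ b ⟧ + m
    absorb true  {m} _   = ≤-reflexive (cong suc (+-identityʳ m))
    absorb false     1≤m = 1≤m
    total : n + e G₋ * (h ∸ 2) ≡ ∑[ x < N ] mult x
    total = sym (begin-equality
      ∑[ x < N ] mult x         ≡⟨ sum-cong-≗ (λ x → *-identityˡ (mult x)) ⟨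
      ∑[ x < N ] (1 * mult x)   ≡⟨ sum-weighted-mult (λ _ → 1) ⟩
      ∑[ u < n ] 1 + ∑[ i < n ] ∑[ j < n ] (ed i j * ∑[ a < h ] (1 * ⟦ isNew i j a ⟧))
        ≡⟨ cong₂ _+_ (sum-ones n) (sum-cong-≗ (λ i → sum-cong-≗ (λ j →
             cong (ed i j *_) (sum-cong-≗ (λ a → *-identityˡ ⟦ isNew i j a ⟧))))) ⟩
      n + ∑[ i < n ] ∑[ j < n ] (ed i j * new i j) ≡⟨ cong (n +_) sum-new ⟩
      n + e G₋ * (h ∸ 2) ∎)

  module _ {nG} {G : Graph nG} {E mG m} (eG≡1+E : e G ≡ suc E) (m₂GH : IsM₂′ G H mG m) (1≤mG : 1ℚ ℚ.≤ mG) where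

    copy-edges : ∀ i j → ℕ→ℚ (ed i j * eS (J-in-copy i j)) ℚ.≤
      m ℚ.* (ℕ→ℚ (ed i j * newInJ i j) ℚ.+ (1ℚ ÷₀ mG) ℚ.* ℕ→ℚ (ed i j * ⟦ vs J (φ i) ∧ vs J (φ j) ⟧))
    copy-edges i j with 0<c , c≤1 , _ ← reciprocal-of-≥1 1≤mG | edge-or-ed≡0 i j
    ... | inj₂ ed≡0 rewrite ed≡0 = affine-nonNeg 0 0 (m₂′-nonNeg G H m₂GH) (ℚ.<⇒≤ 0<c)
    ... | inj₁ ij∈G₋ rewrite ed-of-edge ij∈G₋ | +-identityʳ (eS (J-in-copy i j)) | +-identityʳ (newInJ i j)
                           | +-identityʳ ⟦ vs J (φ i) ∧ vs J (φ j) ⟧ =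
      copy-edge-bound (eS (J-in-copy i j)) (vS (J-in-copy i j)) (newInJ i j) (vs J (φ i)) (vs J (φ j))
        (m₂′-nonNeg G H m₂GH) 0<c c≤1 (2≤vS-of-edge (J-in-copy i j)) (vS-J-in-copy≤ ij∈G₋)
        (subst (λ E → d₂′ E mG (vS (J-in-copy i j)) (eS (J-in-copy i j)) ℚ.≤ m) eG≡1+E (proj₂ m₂GH (J-in-copy i j)))

    eS-J-bound : ℕ→ℚ (eS J) ℚ.≤
      m ℚ.* (ℕ→ℚ newVerticesInJ ℚ.+ (1ℚ ÷₀ mG) ℚ.* ℕ→ℚ (countPairs (restrict (vs J ∘ φ) (adj G₋))))
    eS-J-bound = ℚ.≤-trans (ℕ→ℚ-mono-≤ eS-J≤)
      (subst (λ ε → ℕ→ℚ (∑[ i < n ] ∑[ j < n ] f i j) ℚ.≤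
                    m ℚ.* (ℕ→ℚ newVerticesInJ ℚ.+ (1ℚ ÷₀ mG) ℚ.* ℕ→ℚ ε))
        sum-central-pairs
        (ℕ→ℚ-sum-≤ (λ i → sum (f i)) (λ i → sum (g i)) (λ i → sum (k i)) {m} {1ℚ ÷₀ mG}
          (λ i → ℕ→ℚ-sum-≤ (f i) (g i) (k i) {m} {1ℚ ÷₀ mG} (copy-edges i))))
      where
      f g k : Fin n → Fin n → ℕ
      f i j = ed i j * eS (J-in-copy i j)
      g i j = ed i j * newInJ i j
      k i j = ed i j * ⟦ vs J (φ i) ∧ vs J (φ j) ⟧

open FiniteSums
open RationalBounds
open Subgraphs
open import Data.Nat using (suc)
import Data.Nat as ℕ
open import Data.Integer using (+_)
import Data.Integer as ℤ
import Data.Integer.Properties as ℤ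
open import Data.Rational using (ℚ; 1ℚ; _≤_; _-_)

L≡ : ∀ {nG nH N} (G₋ : Graph nG) (H : Graph nH) (K : Graph N) → 2 ℕ.≤ nH →
  L G₋ H K ≡ + nG ℤ.+ + (e G₋ ℕ.* (nH ℕ.∸ 2)) ℤ.- + N
L≡ {nG} {nH} {N} G₋ H K 2≤nH =
  cong (λ t → + nG ℤ.+ t ℤ.- + N)
    (trans (cong (+ e G₋ ℤ.*_) (trans (ℤ.m-n≡m⊖n nH 2) (ℤ.⊖-≥ 2≤nH))) (sym (ℤ.pos-* (e G₋) (nH ℕ.∸ 2))))

lemma10 : ∀ {nG nH N} (G : Graph nG) (H : Graph nH) (G₋ : Graph nG)
    → ¬ IsMatching G
    → 1 Data.Nat.≤ e H
    → (∀ i j → adj G₋ i j ≡ true → adj G i j ≡ true)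
    → suc (e G₋) ≡ e G
    → (K : Graph N) (φ : Fin nG → Fin N) → CentralCopy G₋ H K φ
    → (u w : Fin nG) → u ≢ w → IsoTo (addPair (adj G₋) u w) G
    → (mG mGH : ℚ) → IsM₂ G mG → IsM₂′ G H mG mGH
    → (J : Subgraph K) → vs J (φ u) ≡ true → vs J (φ w) ≡ true
    → ℤ→ℚ (+ 2 Data.Integer.- L G₋ H K) ≤ ℕ→ℚ (vS J) - (ℕ→ℚ (eS J) ÷₀ mGH)
lemma10 {nG} {nH} {N} G H G₋ ¬matching 1≤eH _ e₋+1≡e K φ cc u w u≢w (σ , iso) mG mGH m₂G m₂GH J Ju Jw =
  final-bound {c = 1ℚ ÷₀ mG} (vS J) (eS J) (count A) newVerticesInJ ε nG N (e G₋ ℕ.* (nH ℕ.∸ 2))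
    (m₂′-nonNeg G H m₂GH) (eS-J-bound {G = G} (sym e₋+1≡e) m₂GH 1≤mG) (density-bound m₂G 1≤mG 2≤|A|)
    2≤|A| vertex-count (L≡ G₋ H K (2≤v-of-edge H 1≤eH))
  where
  open CentralCopyCounting H G₋ K φ cc J
  open Completion G G₋ u≢w σ iso
  A : Fin nG → Bool
  A = vs J ∘ φ
  open Spanned A Ju Jw (uw∉G₋ e₋+1≡e)
  1≤mG : 1ℚ ≤ mG
  1≤mG = m₂≥1-of-¬IsMatching ¬matching m₂G
  2≤|A| : 2 ℕ.≤ count A
  2≤|A| = 2≤count A u≢w Ju Jw
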